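{- Let $p$ be a prime with $p \equiv 1 \pmod 8$ and $p \equiv 2 \pmod 3$. Then there exist infinitely many septuples $(A,B,C,D,E,F,G) \in \mathbb{Z}^7$ which are of the parametrized form below (for some admissible parameters $\lambda,\gamma,\epsilon_0,\delta_0,\mu,t_0,F_0$), which satisfy (A1), (A3), (A4), (A5), (A7), and which satisfy (A6) with respect to $(p,n)$ for every integer $n \ge 1$.
   Context: Parametrized form: $\lambda,\gamma$ are nonzero odd integers with $\gcd(\lambda,3\gamma)=\gcd(p,3\gamma)=\gcd(p,\lambda)=1$; $\epsilon_0,\delta_0$ are nonzero integers with $p\lambda^2\epsilon_0 + 9\gamma^2\delta_0 = 1$; $\mu,t_0,F_0$ are integers; and $A = \frac{p\lambda^2 - 9\gamma^2}{2}$, $B = 2pF_0^2(\delta_0 - \epsilon_0 - \mu(p\lambda^2+9\gamma^2)) + (p\lambda^2+9\gamma^2)t_0F_0$, $C = 2pF_0^2(\delta_0 + \epsilon_0 - \mu(p\lambda^2 - 9\gamma^2)) + (p\lambda^2 - 9\gamma^2)t_0F_0$, $D = \frac{p\lambda^2+9\gamma^2}{2}$, $E = F_0(2pF_0(\epsilon_0 + 9\mu\gamma^2) - 9\gamma^2 t_0)(2F_0(\delta_0 - p\mu\lambda^2) + \lambda^2 t_0)$, $F = 2F_0$, $G = 3\lambda\gamma$. Conditions ($\mathcal{X}_p \subseteq \mathbb{P}^6_{\mathbb{Q}}$ is the threefold $b^2 - c^2 + 2pef = 0$, $2ab - 2cd + pf^2 = 0$, $a^2 - d^2 + pg^2 =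 0$ in coordinates $(a:b:c:d:e:f:g)$; $v_l$ is the $l$-adic valuation): (A1) $(A:B:C:D:E:F:G) \in \mathcal{X}_p(\mathbb{Q})$; (A3) $\gcd(A,D,G)=1$, $E \not\equiv 0 \pmod p$, $G \not\equiv 0 \pmod p$; (A4) for every odd prime $l$ with $\gcd(l,3)=\gcd(l,p)=1$ and $l \mid \gcd(AC-BD, DE-CF, AE-BF)$: $p$ is a square in $\mathbb{Q}_l^\times$; (A5) there is an integer $H$ with $G - EH^6 \equiv 0 \pmod p$ such that $A + \zeta BH^4$ is a quadratic non-residue in $\mathbb{F}_p^\times$ for every cube root of unity $\zeta \in \mathbb{F}_p^\times$; (A6) with respect to $(p,n)$: $v_3(E) - v_3(G) < 6n$; (A7) $A + B \not\equiv 0 \pmod 3$ and $G \equiv 0 \pmod 3$. -}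

module Defs where

open import Data.Nat as ℕ using (ℕ; _%_)
open import Data.Nat.Primality using (Prime)
import Data.Nat.GCD as ℕG
open import Data.Integer as ℤ using (ℤ; +_; _+_; _-_; _*_; _^_; -_)
open import Data.Integer.Divisibility using (_∣_)
open import Data.Integer.GCD using (gcd)
open import Data.Product using (Σ; ∃; _×_; _,_)
open import Data.List using (List)
open import Data.List.Membership.Propositional using (_∉_)
open import Relation.Nullary using (¬_)
open import Relation.Binary.PropositionalEquality using (_≡_; _≢_)

Septuple : Set
Septuple = ℤ × ℤ × ℤ × ℤ × ℤ × ℤ × ℤ

Odd : ℤ → Set
Odd x = ¬ ((+ 2) ∣ x)

Params : Set
Params = ℤ × ℤ × ℤ × ℤ × ℤ × ℤ × ℤ

-- The parametrized form, with respect to the prime p.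
-- A = (pλ²-9γ²)/2 and D = (pλ²+9γ²)/2 are written as 2A = pλ²-9γ², 2D = pλ²+9γ²
-- (the right-hand sides are even since p, λ, γ are odd).
ParamForm : ℕ → Params → Septuple → Set
ParamForm p (lam , gam , ε₀ , δ₀ , μ , t₀ , F₀) (A , B , C , D , E , F , G) =
  let P = + p
      L2 = lam ^ 2
      G2 = gam ^ 2
  in
  (lam ≢ + 0) × (gam ≢ + 0) × Odd lam × Odd gam
  × gcd lam (+ 3 * gam) ≡ + 1 × gcd P (+ 3 * gam) ≡ + 1 × gcd P lam ≡ + 1
  × (ε₀ ≢ + 0) × (δ₀ ≢ + 0)
  × P * L2 * ε₀ + + 9 * G2 * δ₀ ≡ + 1
  × + 2 * A ≡ P * L2 - + 9 * G2
  × B ≡ + 2 * P * F₀ ^ 2 * (δ₀ - ε₀ - μ * (P * L2 + + 9 * G2)) + (P * L2 + + 9 * G2) * t₀ * F₀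
  × C ≡ + 2 * P * F₀ ^ 2 * (δ₀ + ε₀ - μ * (P * L2 - + 9 * G2)) + (P * L2 - + 9 * G2) * t₀ * F₀
  × + 2 * D ≡ P * L2 + + 9 * G2
  × E ≡ F₀ * (+ 2 * P * F₀ * (ε₀ + + 9 * μ * G2) - + 9 * G2 * t₀)
           * (+ 2 * F₀ * (δ₀ - P * μ * L2) + L2 * t₀)
  × F ≡ + 2 * F₀
  × G ≡ + 3 * lam * gam

-- (A1): (A:B:C:D:E:F:G) is a rational point of the threefold X_p ⊆ P⁶.
-- For an integer septuple: not all coordinates zero, and the three equations hold.
A1 : ℕ → Septuple → Set
A1 p (a , b , c , d , e , f , g) =
  ¬ (a ≡ + 0 × b ≡ + 0 × c ≡ + 0 × d ≡ + 0 × e ≡ + 0 × f ≡ + 0 × g ≡ + 0)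
  × b ^ 2 - c ^ 2 + + 2 * + p * e * f ≡ + 0
  × + 2 * a * b - + 2 * c * d + + p * f ^ 2 ≡ + 0
  × a ^ 2 - d ^ 2 + + p * g ^ 2 ≡ + 0

A3 : ℕ → Septuple → Set
A3 p (A , B , C , D , E , F , G) =
  gcd (gcd A D) G ≡ + 1 × ¬ ((+ p) ∣ E) × ¬ ((+ p) ∣ G)

-- "a is a square in ℚ_l^×" for a nonzero integer a and prime l:
-- a ≠ 0 and a is a square in ℤ_l = lim ℤ/l^k, i.e. x² ≡ a (mod l^k) is solvable for every k.
-- (For nonzero integers, being a square in ℚ_l is equivalent to being a square in ℤ_l.)
IsSquareInQl : ℕ → ℤ → Set
IsSquareInQl l a = (a ≢ + 0) × ((k : ℕ) → ∃ λ (x : ℤ) → (+ (l ℕ.^ k)) ∣ (x ^ 2 - a))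

A4 : ℕ → Septuple → Set
A4 p (A , B , C , D , E , F , G) =
  (l : ℕ) → Prime l → l ≢ 2 → ℕG.gcd l 3 ≡ 1 → ℕG.gcd l p ≡ 1 →
  (+ l) ∣ gcd (gcd (A * C - B * D) (D * E - C * F)) (A * E - B * F) →
  IsSquareInQl l (+ p)

QNR : ℕ → ℤ → Set
QNR p a = ¬ ((+ p) ∣ a) × ¬ (∃ λ (x : ℤ) → (+ p) ∣ (x ^ 2 - a))

-- (A5): ζ ranges over integer representatives of cube roots of unity in F_p^×
A5 : ℕ → Septuple → Set
A5 p (A , B , C , D , E , F , G) =
  ∃ λ (H : ℤ) → ((+ p) ∣ (G - E * H ^ 6))
    × ((ζ : ℤ) → (+ p) ∣ (ζ ^ 3 - + 1) → QNR p (A + ζ * B * H ^ 4))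

IsVal : ℕ → ℤ → ℕ → Set
IsVal l x k = (+ (l ℕ.^ k)) ∣ x × ¬ ((+ (l ℕ.^ (ℕ.suc k))) ∣ x)

A6 : ℕ → ℕ → Septuple → Set
A6 p n (A , B , C , D , E , F , G) =
  ∃ λ (vE : ℕ) → ∃ λ (vG : ℕ) →
    IsVal 3 E vE × IsVal 3 G vG × (ℤ.+ vE ℤ.- ℤ.+ vG) ℤ.< ℤ.+ (6 ℕ.* n)

A7 : Septuple → Set
A7 (A , B , C , D , E , F , G) = ¬ ((+ 3) ∣ (A + B)) × (+ 3) ∣ G

Good : ℕ → Septuple → Set
Good p s =
  (∃ λ (ps : Params) → ParamForm p ps s)
  × A1 p s × A3 p s × A4 p s × A5 p s × A7 s
  × ((n : ℕ) → 1 ℕ.≤ n → A6 p n s)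

Infinite : (Septuple → Set) → Set
Infinite S = (xs : List Septuple) → ∃ λ s → S s × s ∉ xs

module Submission where

-- Take γ = F₀ = 1 and vary only μ. Modulo p the coordinates collapse to B ≡ 9t and E ≡ -9t(2δ + λ²t),
-- and the Bézout relation gives 9δ ≡ 1. Choosing λ ≡ 18√2 - 24 (√2 exists as p ≡ 1 mod 8) and
-- 324t ≡ -1 makes G ≡ 3⁶E, so H = 3 works in (A5), and turns A + ζB·3⁴ into -27/4 = -3·(3/2)², a
-- non-residue because cubing is a bijection mod p ≡ 2 (mod 3). Modulo 3 everything is fixed by
-- p ≡ λ ≡ 2, t ≡ 1, μ ≡ -δ, which gives (A6) and (A7); (A4) holds vacuously because 3pF⁶ lies in the
-- ideal spanned by the equations of 𝒳_p and two of the minors. Finally C - B = 4pε + 36pμ - 18t is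
-- injective in μ, so μ = -δ + 3k gives infinitely many septuples.

open import Defs
open import Data.Nat using (ℕ; _%_)
open import Data.Nat.Primality using (Prime)
open import Relation.Binary.PropositionalEquality using (_≡_)

open import Algebra.Bundles using (CommutativeRing; Monoid)
open import Data.Empty using (⊥-elim)
open import Data.Fin.Base as Fin using (Fin; toℕ)
import Data.Fin.Properties as Fin
open import Data.Integer.Base as ℤ using (ℤ; +_; _+_; _-_; _*_; _^_; -_)
import Data.Integer.DivMod as ℤ
import Data.Integer.Divisibility as ℤU
open import Data.Integer.Divisibility.Signed
import Data.Integer.GCD as ℤ
import Data.Integer.Properties as ℤ
open import Data.Integer.Tactic.RingSolver using (solve-∀)
open import Data.Integer.Solver using (module +-*-Solver)
open +-*-Solver using (solve; _:=_; _:+_; _:*_; _:-_; :-_; _:^_; con; Polynomial)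
open import Data.List.Base using ([]; _∷_; length; lookup)
open import Data.List.Membership.Propositional using (_∈_)
open import Data.List.Relation.Unary.Any as Any using ()
open import Data.List.Relation.Unary.Any.Properties using (lookup-index)
open import Data.Nat.Base as ℕ using (ℕ; zero; suc; _!; _%_; _/_)
open import Data.Nat.Combinatorics using (_C_; nCk≡n!/k![n-k]!; k![n∸k]!∣n!; nCn≡1)
import Data.Nat.DivMod as ℕ
import Data.Nat.Divisibility as ℕ
import Data.Nat.GCD as ℕ
open import Data.Nat.Primality using (Prime; euclidsLemma; prime?; prime⇒irreducible; prime⇒nonTrivial; prime⇒nonZero)
import Data.Nat.Properties as ℕ
open import Data.Product.Base using (∃; _×_; _,_; proj₁; proj₂)
open import Data.Product.Properties using (≡-dec)
open import Data.Sum.Base using (_⊎_; inj₁; inj₂; [_,_]′)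
open import Data.Vec.Base using (Vec; []; _∷_)
open import Data.Vec.Functional using (init; last; tail)
open import Data.Vec.Relation.Unary.All as All using (All; []; _∷_)
open import Function.Base using (_∘_; id)
open import Level using (0ℓ)
open import Relation.Binary.Bundles using (Setoid)
open import Relation.Binary.PropositionalEquality using (module ≡-Reasoning)
open import Relation.Binary.PropositionalEquality.Core as ≡ using (_≡_; _≢_)
import Relation.Binary.Reasoning.Setoid as SetoidReasoning
open import Relation.Binary.Structures using (IsEquivalence)
open import Relation.Nullary.Decidable.Core as Dec using (yes; no; from-yes; from-no)
open import Relation.Nullary.Negation.Core using (¬_)
import Algebra.Solver.Ring.AlmostCommutativeRing as ACR
import Algebra.Solver.Ring.Simple as Simple-Solver
open import Data.List.Membership.DecPropositional (≡-dec ℤ._≟_ (≡-dec ℤ._≟_ (≡-dec ℤ._≟_ (≡-dec ℤ._≟_ (≡-dec ℤ._≟_ (≡-dec ℤ._≟_ ℤ._≟_))))))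
  using (_∈?_)

-- Congruences modulo m

infix 4 Congruent
record Congruent (m x y : ℤ) : Set where
  constructor congruent
  field m∣x-y : m ∣ x - y

syntax Congruent m x y = x ≡ y mod m

module Modulo (m : ℤ) where

  private
    diff-refl : ∀ x → x - x ≡ + 0
    diff-refl = solve-∀
    diff-sym : ∀ x y → y - x ≡ - (x - y)
    diff-sym = solve-∀
    diff-trans : ∀ x y z → x - z ≡ (x - y) + (y - z)
    diff-trans = solve-∀
    diff-+ : ∀ x y u v → (x + u) - (y + v) ≡ (x - y) + (u - v)
    diff-+ = solve-∀
    diff-* : ∀ x y u v → x * u - y * v ≡ (x - y) * u + y * (u - v)
    diff-* = solve-∀
    diff-neg : ∀ x y → - x - - y ≡ - (x - y)
    diff-neg = solve-∀
    diff-0 : ∀ x → x - + 0 ≡ x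
    diff-0 = solve-∀

  m∣0 : m ∣ + 0
  m∣0 = divides (+ 0) (≡.sym (ℤ.*-zeroˡ m))

  ≈⇒≡+multiple : ∀ {x r} → x ≡ r mod m → ∃ λ q → x ≡ r + m * q
  ≈⇒≡+multiple {x} {r} (congruent (divides q x-r≡qm)) =
    q , ≡.trans (split x r) (≡.cong (_+_ r) (≡.trans x-r≡qm (ℤ.*-comm q m)))
    where
    split : ∀ x r → x ≡ r + (x - r)
    split = solve-∀

  ≈-refl : ∀ {x} → x ≡ x mod m
  ≈-refl {x} = congruent (≡.subst (m ∣_) (≡.sym (diff-refl x)) m∣0)

  ≈-reflexive : ∀ {x y} → x ≡ y → x ≡ y mod m
  ≈-reflexive ≡.refl = ≈-refl

  ≈-sym : ∀ {x y} → x ≡ y mod m → y ≡ x mod m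
  ≈-sym {x} {y} (congruent d) = congruent (≡.subst (m ∣_) (≡.sym (diff-sym x y)) (∣m⇒∣-m d))

  ≈-trans : ∀ {x y z} → x ≡ y mod m → y ≡ z mod m → x ≡ z mod m
  ≈-trans {x} {y} {z} (congruent d) (congruent e) =
    congruent (≡.subst (m ∣_) (≡.sym (diff-trans x y z)) (∣m∣n⇒∣m+n d e))

  +-cong : ∀ {x y u v} → x ≡ y mod m → u ≡ v mod m → x + u ≡ y + v mod m
  +-cong {x} {y} {u} {v} (congruent d) (congruent e) =
    congruent (≡.subst (m ∣_) (≡.sym (diff-+ x y u v)) (∣m∣n⇒∣m+n d e))

  *-cong : ∀ {x y u v} → x ≡ y mod m → u ≡ v mod m → x * u ≡ y * v mod m
  *-cong {x} {y} {u} {v} (congruent d) (congruent e) =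
    congruent (≡.subst (m ∣_) (≡.sym (diff-* x y u v)) (∣m∣n⇒∣m+n (∣m⇒∣m*n u d) (∣n⇒∣m*n y e)))

  -‿cong : ∀ {x y} → x ≡ y mod m → - x ≡ - y mod m
  -‿cong {x} {y} (congruent d) = congruent (≡.subst (m ∣_) (≡.sym (diff-neg x y)) (∣m⇒∣-m d))

  ^-cong : ∀ {x y} n → x ≡ y mod m → x ^ n ≡ y ^ n mod m
  ^-cong zero    _   = ≈-refl
  ^-cong (suc n) x≈y = *-cong x≈y (^-cong n x≈y)

  ∣⇒≈0 : ∀ {x} → m ∣ x → x ≡ + 0 mod m
  ∣⇒≈0 {x} d = congruent (≡.subst (m ∣_) (≡.sym (diff-0 x)) d)

  ≈0⇒∣ : ∀ {x} → x ≡ + 0 mod m → m ∣ x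
  ≈0⇒∣ {x} (congruent d) = ≡.subst (m ∣_) (diff-0 x) d

  multiple⇒≈ : ∀ {x y} q → x ≡ y + q * m → x ≡ y mod m
  multiple⇒≈ {x} {y} q ≡.refl = congruent (divides q (cancel y (q * m)))
    where
    cancel : ∀ a b → (a + b) - a ≡ b
    cancel = solve-∀

  ∣-respʳ-≈ : ∀ {x y} → x ≡ y mod m → m ∣ x → m ∣ y
  ∣-respʳ-≈ x≈y m∣x = ≈0⇒∣ (≈-trans (≈-sym x≈y) (∣⇒≈0 m∣x))

  +-absorbˡ : ∀ {y} x → m ∣ y → y + x ≡ x mod m
  +-absorbˡ {y} x m∣y = ≈-trans (+-cong (∣⇒≈0 m∣y) ≈-refl) (≈-reflexive (ℤ.+-identityˡ x))

  isEquivalence : IsEquivalence (Congruent m)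
  isEquivalence = record { refl = ≈-refl ; sym = ≈-sym ; trans = ≈-trans }

  setoid : Setoid 0ℓ 0ℓ
  setoid = record { isEquivalence = isEquivalence }

  module ≈-Reasoning = SetoidReasoning setoid

  commutativeRing : CommutativeRing 0ℓ 0ℓ
  commutativeRing = record
    { Carrier = ℤ ; _≈_ = Congruent m ; _+_ = _+_ ; _*_ = _*_ ; -_ = -_ ; 0# = + 0 ; 1# = + 1
    ; isCommutativeRing = record
      { isRing = record
        { +-isAbelianGroup = record
          { isGroup = record
            { isMonoid = record
              { isSemigroup = record
                { isMagma = record { isEquivalence = isEquivalence ; ∙-cong = +-cong }
                ; assoc = λ x y z → ≈-reflexive (ℤ.+-assoc x y z) }
              ; identity = (λ x → ≈-reflexive (ℤ.+-identityˡ x)) , (λ x → ≈-reflexive (ℤ.+-identityʳ x)) }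
            ; inverse = (λ x → ≈-reflexive (ℤ.+-inverseˡ x)) , (λ x → ≈-reflexive (ℤ.+-inverseʳ x))
            ; ⁻¹-cong = -‿cong }
          ; comm = λ x y → ≈-reflexive (ℤ.+-comm x y) }
        ; *-cong = *-cong
        ; *-assoc = λ x y z → ≈-reflexive (ℤ.*-assoc x y z)
        ; *-identity = (λ x → ≈-reflexive (ℤ.*-identityˡ x)) , (λ x → ≈-reflexive (ℤ.*-identityʳ x))
        ; distrib = (λ x y z → ≈-reflexive (ℤ.*-distribˡ-+ x y z))
                  , (λ x y z → ≈-reflexive (ℤ.*-distribʳ-+ x y z)) }
      ; *-comm = λ x y → ≈-reflexive (ℤ.*-comm x y) } }

-- Divisibility by primes

∤-between : ∀ {m n} → 0 ℕ.< n → n ℕ.< m → ¬ + m ∣ + n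
∤-between {n = suc _} _ n<m m∣n = ℕ.<⇒≱ n<m (ℕ.∣⇒≤ (∣⇒∣ᵤ m∣n))

quotient-remainder : ∀ {p n r} .{{_ : ℕ.NonZero n}} → p ℕ.% n ≡ r → + p ≡ + r + + (p ℕ./ n) * + n
quotient-remainder {p} {n} {r} p%n≡r =
  ≡.trans (≡.cong +_ (≡.trans (ℕ.m≡m%n+[m/n]*n p n) (≡.cong (ℕ._+ p ℕ./ n ℕ.* n) p%n≡r)))
          (≡.cong (_+_ (+ r)) (ℤ.pos-* (p ℕ./ n) n))

n∣n! : ∀ {n} → 0 ℕ.< n → n ℕ.∣ n !
n∣n! {suc n} _ = ℕ.m∣m*n (n !)

module _ {p : ℕ} (p-prime : Prime p) where

  prime>1 : 1 ℕ.< p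
  prime>1 = ℕ.nonTrivial⇒n>1 p {{prime⇒nonTrivial p-prime}}

  prime∤1 : ¬ + p ∣ + 1
  prime∤1 = ∤-between ℕ.z<s prime>1

  euclid : ∀ x y → + p ∣ x * y → + p ∣ x ⊎ + p ∣ y
  euclid x y p∣xy with euclidsLemma ℤ.∣ x ∣ ℤ.∣ y ∣ p-prime (≡.subst (p ℕ.∣_) (ℤ.abs-* x y) (∣⇒∣ᵤ p∣xy))
  ... | inj₁ p∣x = inj₁ (∣ᵤ⇒∣ p∣x)
  ... | inj₂ p∣y = inj₂ (∣ᵤ⇒∣ p∣y)

  ∤-* : ∀ {x y} → ¬ + p ∣ x → ¬ + p ∣ y → ¬ + p ∣ x * y
  ∤-* {x} {y} p∤x p∤y p∣xy = [ p∤x , p∤y ]′ (euclid x y p∣xy)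

  ∣-cancelˡ : ∀ {x y} → ¬ + p ∣ x → + p ∣ x * y → + p ∣ y
  ∣-cancelˡ {x} {y} p∤x p∣xy = [ (λ p∣x → ⊥-elim (p∤x p∣x)) , (λ p∣y → p∣y) ]′ (euclid x y p∣xy)

  ∣^⇒∣ : ∀ {x} n → + p ∣ x ^ suc n → + p ∣ x
  ∣^⇒∣ {x} zero    p∣x¹ = ∣-cancelˡ prime∤1 (≡.subst (+ p ∣_) (ℤ.*-comm x (+ 1)) p∣x¹)
  ∣^⇒∣ {x} (suc n) p∣xⁿ⁺² = [ (λ p∣x → p∣x) , ∣^⇒∣ n ]′ (euclid x (x ^ suc n) p∣xⁿ⁺²)

  prime∤⇒gcd≡1 : ∀ {n} → ¬ p ℕ.∣ n → ℕ.gcd n p ≡ 1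
  prime∤⇒gcd≡1 {n} p∤n =
    [ (λ gcd≡1 → gcd≡1) , (λ gcd≡p → ⊥-elim (p∤n (≡.subst (ℕ._∣ n) gcd≡p (ℕ.gcd[m,n]∣m n p)))) ]′
      (prime⇒irreducible p-prime (ℕ.gcd[m,n]∣n n p))

  prime∤! : ∀ m → m ℕ.< p → ¬ p ℕ.∣ m !
  prime∤! zero    _   p∣1 = ℕ.<⇒≢ prime>1 (≡.sym (ℕ.∣1⇒≡1 p∣1))
  prime∤! (suc m) m<p p∣m! with euclidsLemma (suc m) (m !) p-prime p∣m!
  ... | inj₁ p∣m+1 = ℕ.<⇒≱ m<p (ℕ.∣⇒≤ p∣m+1)
  ... | inj₂ p∣m!  = prime∤! m (ℕ.<-trans (ℕ.n<1+n m) m<p) p∣m!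

  prime∣choose : ∀ {k} → 0 ℕ.< k → k ℕ.< p → p ℕ.∣ p C k
  prime∣choose {k} 0<k k<p =
    [ (λ p∣pCk → p∣pCk) , (λ p∣k![p∸k]! → ⊥-elim ([ prime∤! k k<p , prime∤! (p ℕ.∸ k) p∸k<p ]′
                                            (euclidsLemma (k !) ((p ℕ.∸ k) !) p-prime p∣k![p∸k]!))) ]′
      (euclidsLemma (p C k) (k ! ℕ.* (p ℕ.∸ k) !) p-prime
                    (≡.subst (p ℕ.∣_) (≡.sym p!) (n∣n! (ℕ.<-trans ℕ.z<s prime>1))))
    where
    instance
      _ : ℕ.NonZero (k ! ℕ.* (p ℕ.∸ k) !)
      _ = k ℕ.!* (p ℕ.∸ k) !≢0
    p! : (p C k) ℕ.* (k ! ℕ.* (p ℕ.∸ k) !) ≡ p !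
    p! = ≡.trans (≡.cong (ℕ._* (k ! ℕ.* (p ℕ.∸ k) !)) (nCk≡n!/k![n-k]! (ℕ.<⇒≤ k<p)))
                 (ℕ.m/n*n≡m (k![n∸k]!∣n! (ℕ.<⇒≤ k<p)))
    p∸k<p : p ℕ.∸ k ℕ.< p
    p∸k<p = ℕ.∸-monoʳ-< 0<k (ℕ.<⇒≤ k<p)

-- Fermat's little theorem

module _ {n : ℕ} where
  private
    p = suc n
  open Modulo (+ p)
  open CommutativeRing commutativeRing using (commutativeSemiring; +-monoid; semiring)
  open import Algebra.Properties.CommutativeSemiring.Binomial commutativeSemiring
    using (theorem; binomialTerm)
  open import Algebra.Properties.Semiring.Exp semiring using () renaming (_^_ to _^ᴿ_)
  open import Algebra.Definitions.RawMonoid (Monoid.rawMonoid +-monoid) using (sum) renaming (_×_ to _×ᴿ_)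
  open import Algebra.Properties.Monoid.Sum +-monoid using (sum-init-last; sum-cong-≋; sum-replicate-zero)
  open ≈-Reasoning

  private
    ^ᴿ≡^ : ∀ x m → x ^ᴿ m ≡ x ^ m
    ^ᴿ≡^ x zero    = ≡.refl
    ^ᴿ≡^ x (suc m) = ≡.cong (x *_) (^ᴿ≡^ x m)

    ×ᴿ≡* : ∀ m x → m ×ᴿ x ≡ + m * x
    ×ᴿ≡* zero    x = ≡.sym (ℤ.*-zeroˡ x)
    ×ᴿ≡* (suc m) x = ≡.trans (≡.cong (_+_ x) (×ᴿ≡* m x)) (≡.sym (ℤ.suc-* (+ m) x))

  -- Binomial theorem in ℤ/pℤ, where the middle coefficients p C k vanish.
  freshmans-dream : Prime p → ∀ x → (x + + 1) ^ p ≡ x ^ p + + 1 mod + p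
  freshmans-dream p-prime x = begin
    (x + + 1) ^ p                              ≡⟨ ^ᴿ≡^ (x + + 1) p ⟨
    (x + + 1) ^ᴿ p                             ≈⟨ theorem p x (+ 1) ⟩
    term Fin.zero + sum (tail term)            ≈⟨ +-cong (≈-refl {term Fin.zero}) (sum-init-last (tail term)) ⟩
    term Fin.zero + (sum middle + last (tail term)) ≈⟨ +-cong first (+-cong middle≈0 final) ⟩
    + 1 + (+ 0 + x ^ p)                        ≡⟨ rearrange (x ^ p) ⟩
    x ^ p + + 1                                ∎
    where
    term = binomialTerm x (+ 1) p
    middle = init (tail term)
    rearrange : ∀ y → + 1 + (+ 0 + y) ≡ y + + 1
    rearrange = solve-∀
    first : term Fin.zero ≡ + 1 mod + p
    first = ≈-reflexive (≡.trans (×ᴿ≡* 1 _) (≡.trans (ℤ.*-identityˡ _) (≡.trans (ℤ.*-identityˡ _)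
              (≡.trans (^ᴿ≡^ (+ 1) p) (ℤ.^-zeroˡ p)))))
    middle≈0 : sum middle ≡ + 0 mod + p
    middle≈0 = ≈-trans (sum-cong-≋ vanishes) (sum-replicate-zero n)
      where
      choose-term≈0 : ∀ {k} z → 0 ℕ.< k → k ℕ.< p → (p C k) ×ᴿ z ≡ + 0 mod + p
      choose-term≈0 {k} z 0<k k<p =
        ∣⇒≈0 (≡.subst (+ p ∣_) (≡.sym (×ᴿ≡* (p C k) z))
                      (∣m⇒∣m*n z (∣ᵤ⇒∣ {+ p} {+ (p C k)} (prime∣choose p-prime 0<k k<p))))
      vanishes : ∀ i → middle i ≡ + 0 mod + p
      vanishes i = choose-term≈0 _ ℕ.z<s
        (ℕ.s≤s (≡.subst (ℕ._< n) (≡.sym (Fin.toℕ-inject₁ i)) (Fin.toℕ<n i)))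
    final : last (tail term) ≡ x ^ p mod + p
    final = ≈-reflexive (≡.trans (≡.cong summand (Fin.toℕ-fromℕ n))
      (≡.trans (≡.cong (_×ᴿ z) (nCn≡1 p)) (≡.trans (×ᴿ≡* 1 z) (≡.trans (ℤ.*-identityˡ z)
      (≡.trans (≡.cong₂ _*_ (^ᴿ≡^ x p) (≡.trans (^ᴿ≡^ (+ 1) (p ℕ.∸ p)) (ℤ.^-zeroˡ (p ℕ.∸ p))))
               (ℤ.*-identityʳ (x ^ p)))))))
      where
      z = x ^ᴿ p * (+ 1) ^ᴿ (p ℕ.∸ p)
      summand : ℕ → ℤ
      summand m = (p C suc m) ×ᴿ (x ^ᴿ suc m * (+ 1) ^ᴿ (p ℕ.∸ suc m))

fermat : ∀ {p} → Prime p → ∀ x → x ^ p ≡ x mod + p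
fermat {zero}  p-prime = ⊥-elim (ℕ.<⇒≱ (prime>1 p-prime) ℕ.z≤n)
fermat {suc n} p-prime x = begin
  x ^ p     ≈⟨ ^-cong p x≈r ⟩
  (+ r) ^ p ≈⟨ fermat-ℕ r ⟩
  + r       ≈⟨ ≈-sym x≈r ⟩
  x         ∎
  where
  p = suc n
  open Modulo (+ p)
  open ≈-Reasoning
  r = x ℤ.% + p
  x≈r : x ≡ + r mod + p
  x≈r = multiple⇒≈ (x ℤ./ + p) (ℤ.a≡a%n+[a/n]*n x (+ p))
  fermat-ℕ : ∀ m → (+ m) ^ p ≡ + m mod + p
  fermat-ℕ zero    = ≈-reflexive (ℤ.*-zeroˡ ((+ 0) ^ n))
  fermat-ℕ (suc m) = begin
    (+ suc m) ^ p       ≡⟨ ≡.cong (_^ p) +suc ⟩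
    (+ m + + 1) ^ p     ≈⟨ freshmans-dream p-prime (+ m) ⟩
    (+ m) ^ p + + 1     ≈⟨ +-cong (fermat-ℕ m) ≈-refl ⟩
    + m + + 1           ≡⟨ +suc ⟨
    + suc m             ∎
    where
    +suc : + suc m ≡ + m + + 1
    +suc = ≡.cong +_ (ℕ.+-comm 1 m)

-- Cubes modulo p ≡ 2 (mod 3)

module _ {p : ℕ} (p-prime : Prime p) (p%3≡2 : p % 3 ≡ 2) where
  open Modulo (+ p)

  private
    power-split : ∀ x → x ^ p ≡ x ^ 2 * (x ^ 3) ^ (p / 3)
    power-split x = begin
      x ^ p                          ≡⟨ ≡.cong (x ^_) p≡2+q*3 ⟩
      x ^ (2 ℕ.+ q ℕ.* 3)            ≡⟨ ℤ.^-distribˡ-+-* x 2 (q ℕ.* 3) ⟩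
      x ^ 2 * x ^ (q ℕ.* 3)          ≡⟨ ≡.cong (λ e → x ^ 2 * x ^ e) (ℕ.*-comm q 3) ⟩
      x ^ 2 * x ^ (3 ℕ.* q)          ≡⟨ ≡.cong (x ^ 2 *_) (ℤ.^-*-assoc x 3 q) ⟨
      x ^ 2 * (x ^ 3) ^ q            ∎
      where
      open ≡-Reasoning
      q = p / 3
      p≡2+q*3 : p ≡ 2 ℕ.+ q ℕ.* 3
      p≡2+q*3 = ≡.trans (ℕ.m≡m%n+[m/n]*n p 3) (≡.cong (ℕ._+ q ℕ.* 3) p%3≡2)

  cube-injective : ∀ {x y} → x ^ 3 ≡ y ^ 3 mod + p → x ≡ y mod + p
  cube-injective {x} {y} x³≈y³ with + p ∣? x
  ... | yes p∣x = ≈-trans (∣⇒≈0 p∣x) (≈-sym (∣⇒≈0 p∣y))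
    where
    p∣y : + p ∣ y
    p∣y = ∣^⇒∣ p-prime 2 (≈0⇒∣ (≈-trans (≈-sym x³≈y³) (∣⇒≈0 (∣m⇒∣m*n (x ^ 2) p∣x))))
  ... | no p∤x = congruent (∣-cancelˡ p-prime (∤-* p-prime p∤x p∤y) (≈0⇒∣ xy[x-y]≈0))
    where
    open ≈-Reasoning
    p∤y : ¬ + p ∣ y
    p∤y p∣y = p∤x (∣^⇒∣ p-prime 2 (≈0⇒∣ (≈-trans x³≈y³ (∣⇒≈0 (∣m⇒∣m*n (y ^ 2) p∣y)))))
    W = (y ^ 3) ^ (p / 3)
    -- Fermat turns x into x² (x³)^(p/3), and x³ ≡ y³ makes the second factor common to x and y.
    x≈x²W : x ≡ x ^ 2 * W mod + p
    x≈x²W = begin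
      x                          ≈⟨ fermat p-prime x ⟨
      x ^ p                      ≡⟨ power-split x ⟩
      x ^ 2 * (x ^ 3) ^ (p / 3)  ≈⟨ *-cong (≈-refl {x ^ 2}) (^-cong (p / 3) x³≈y³) ⟩
      x ^ 2 * W                  ∎
    y≈y²W : y ≡ y ^ 2 * W mod + p
    y≈y²W = ≈-trans (≈-sym (fermat p-prime y)) (≈-reflexive (power-split y))
    xy[x-y]≈0 : x * y * (x - y) ≡ + 0 mod + p
    xy[x-y]≈0 = begin
      x * y * (x - y)                        ≡⟨ expand x y ⟩
      x ^ 2 * y - y ^ 2 * x                  ≈⟨ +-cong (*-cong (≈-refl {x ^ 2}) y≈y²W)
                                                        (-‿cong (*-cong (≈-refl {y ^ 2}) x≈x²W)) ⟩
      x ^ 2 * (y ^ 2 * W) - y ^ 2 * (x ^ 2 * W) ≡⟨ cancel x y W ⟩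
      + 0                                    ∎
      where
      expand : ∀ x y → x * y * (x - y) ≡ x ^ 2 * y - y ^ 2 * x
      expand = solve 2 (λ x y → x :* y :* (x :- y) := x :^ 2 :* y :- y :^ 2 :* x) ≡.refl
      cancel : ∀ x y w → x ^ 2 * (y ^ 2 * w) - y ^ 2 * (x ^ 2 * w) ≡ + 0
      cancel = solve 3 (λ x y w → x :^ 2 :* (y :^ 2 :* w) :- y :^ 2 :* (x :^ 2 :* w) := con (+ 0)) ≡.refl

  x²+3c²≢0 : ∀ {x c} → ¬ + p ∣ + 2 → ¬ + p ∣ + 3 → ¬ + p ∣ c → ¬ x ^ 2 + + 3 * c ^ 2 ≡ + 0 mod + p
  x²+3c²≢0 {x} {c} p∤2 p∤3 p∤c x²+3c²≈0 =
    ∤-* p-prime p∤2 (∤-* p-prime p∤2 (∤-* p-prime p∤3 (∤-* p-prime p∤c p∤c))) (≡.subst (+ p ∣_) (twelve x c)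
      (∣m∣n⇒∣m-n (≈0⇒∣ x²+3c²≈0) (∣m⇒∣m*n (x + + 3 * c) (Congruent.m∣x-y x≈3c))))
    where
    open ≈-Reasoning
    twelve : ∀ x c → x ^ 2 + + 3 * c ^ 2 - (x - + 3 * c) * (x + + 3 * c) ≡ + 2 * (+ 2 * (+ 3 * (c * c)))
    twelve = solve 2 (λ x c → x :^ 2 :+ con (+ 3) :* c :^ 2 :- (x :- con (+ 3) :* c) :* (x :+ con (+ 3) :* c)
                              := con (+ 2) :* (con (+ 2) :* (con (+ 3) :* (c :* c)))) ≡.refl
    -- (x - c)³ - (2c)³ = (x - 3c)(x² + 3c²), so x - c ≡ 2c by injectivity of cubing.
    x-c≈2c : x - c ≡ + 2 * c mod + p
    x-c≈2c = cube-injective (begin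
      (x - c) ^ 3                                           ≡⟨ factor x c ⟩
      (+ 2 * c) ^ 3 + (x - + 3 * c) * (x ^ 2 + + 3 * c ^ 2) ≈⟨ +-cong (≈-refl {(+ 2 * c) ^ 3})
                                                                      (*-cong (≈-refl {x - + 3 * c}) x²+3c²≈0) ⟩
      (+ 2 * c) ^ 3 + (x - + 3 * c) * + 0                   ≡⟨ drop-zero ((+ 2 * c) ^ 3) (x - + 3 * c) ⟩
      (+ 2 * c) ^ 3                                         ∎)
      where
      factor : ∀ x c → (x - c) ^ 3 ≡ (+ 2 * c) ^ 3 + (x - + 3 * c) * (x ^ 2 + + 3 * c ^ 2)
      factor = solve 2 (λ x c → (x :- c) :^ 3
                                := (con (+ 2) :* c) :^ 3 :+ (x :- con (+ 3) :* c) :* (x :^ 2 :+ con (+ 3) :* c :^ 2)) ≡.refl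
      drop-zero : ∀ a b → a + b * + 0 ≡ a
      drop-zero = solve-∀
    x≈3c : x ≡ + 3 * c mod + p
    x≈3c = begin
      x             ≡⟨ split x c ⟩
      (x - c) + c   ≈⟨ +-cong x-c≈2c (≈-refl {c}) ⟩
      + 2 * c + c   ≡⟨ merge c ⟩
      + 3 * c       ∎
      where
      split : ∀ x c → x ≡ (x - c) + c
      split = solve-∀
      merge : ∀ c → + 2 * c + c ≡ + 3 * c
      merge = solve-∀

-- Roots of polynomials and √2 modulo p ≡ 1 (mod 8)

-- Coefficient vectors, constant term first.
eval : ∀ {n} → Vec ℤ n → ℤ → ℤ
eval []       x = + 0
eval (a ∷ as) x = a + x * eval as x

monomial : ∀ k → Vec ℤ (suc k)
monomial zero    = + 1 ∷ []
monomial (suc k) = + 0 ∷ monomial k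

eval-monomial : ∀ k x → eval (monomial k) x ≡ x ^ k
eval-monomial zero    x = constant x
  where
  constant : ∀ x → + 1 + x * + 0 ≡ + 1
  constant = solve-∀
eval-monomial (suc k) x = ≡.trans (ℤ.+-identityˡ _) (≡.cong (x *_) (eval-monomial k x))

divide : ∀ {n} → Vec ℤ (suc n) → ℤ → Vec ℤ n × ℤ
divide (a ∷ [])     r = [] , a
divide (a ∷ b ∷ as) r with divide (b ∷ as) r
... | q , ρ = ρ ∷ q , a + r * ρ

divide-correct : ∀ {n} (f : Vec ℤ (suc n)) r x →
                 eval f x ≡ (x - r) * eval (proj₁ (divide f r)) x + proj₂ (divide f r)
divide-correct (a ∷ [])     r x = constant a x r
  where
  constant : ∀ a x r → a + x * + 0 ≡ (x - r) * + 0 + a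
  constant = solve-∀
divide-correct (a ∷ b ∷ as) r x with divide (b ∷ as) r | divide-correct (b ∷ as) r x
... | q , ρ | ih = ≡.trans (≡.cong (λ v → a + x * v) ih) (step a x r (eval q x) ρ)
  where
  step : ∀ a x r Q ρ → a + x * ((x - r) * Q + ρ) ≡ (x - r) * (ρ + x * Q) + (a + r * ρ)
  step = solve-∀

divide-remainder : ∀ {n} (f : Vec ℤ (suc n)) r → proj₂ (divide f r) ≡ eval f r
divide-remainder f r = ≡.sym (≡.trans (divide-correct f r r) (vanish r (eval (proj₁ (divide f r)) r) _))
  where
  vanish : ∀ r q ρ → (r - r) * q + ρ ≡ ρ
  vanish = solve-∀

module _ {p : ℕ} (p-prime : Prime p) where

  private
    P = + p

  divide-vanishes : ∀ {n} (f : Vec ℤ (suc n)) r →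
                    All (P ∣_) (proj₁ (divide f r)) → P ∣ proj₂ (divide f r) → All (P ∣_) f
  divide-vanishes (a ∷ [])     r []         p∣ρ = p∣ρ ∷ []
  divide-vanishes (a ∷ b ∷ as) r (p∣ρ′ ∷ p∣q) p∣ρ with divide (b ∷ as) r | divide-vanishes (b ∷ as) r
  ... | q , ρ′ | ih = ≡.subst (P ∣_) (recover a r ρ′) (∣m∣n⇒∣m-n p∣ρ (∣n⇒∣m*n r p∣ρ′)) ∷ ih p∣q p∣ρ′
    where
    recover : ∀ a r ρ → (a + r * ρ) - r * ρ ≡ a
    recover = solve-∀

  coefficients-vanish : ∀ {n} (f : Vec ℤ n) (r : Fin n → ℤ) →
                        (∀ {i j} → i ≢ j → ¬ P ∣ r i - r j) → (∀ i → P ∣ eval f (r i)) → All (P ∣_) f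
  coefficients-vanish []          r _        _     = []
  coefficients-vanish f@(_ ∷ _)   r distinct roots =
    divide-vanishes f (r Fin.zero) (coefficients-vanish q (r ∘ Fin.suc) (distinct ∘ (_∘ Fin.suc-injective)) q-roots)
      p∣ρ
    where
    q = proj₁ (divide f (r Fin.zero))
    ρ = proj₂ (divide f (r Fin.zero))
    p∣ρ : P ∣ ρ
    p∣ρ = ≡.subst (P ∣_) (≡.sym (divide-remainder f (r Fin.zero))) (roots Fin.zero)
    q-roots : ∀ i → P ∣ eval q (r (Fin.suc i))
    q-roots i = ∣-cancelˡ p-prime (distinct λ ()) (≡.subst (P ∣_) (isolate (r (Fin.suc i)) (r Fin.zero) _ ρ)
      (∣m∣n⇒∣m-n (≡.subst (P ∣_) (divide-correct f (r Fin.zero) (r (Fin.suc i))) (roots (Fin.suc i))) p∣ρ))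
      where
      isolate : ∀ x r q ρ → (x - r) * q + ρ - ρ ≡ (x - r) * q
      isolate = solve-∀

  ∣m-n⇒m≡n : ∀ {m n} → m ℕ.< p → n ℕ.< p → P ∣ + m - + n → m ≡ n
  ∣m-n⇒m≡n {m} {n} m<p n<p p∣m-n =
    ℤ.+-injective (ℤ.i-j≡0⇒i≡j (+ m) (+ n) (ℤ.∣i∣≡0⇒i≡0 (small-multiple (∣⇒∣ᵤ p∣m-n) d<p)))
    where
    d<p : ℤ.∣ + m - + n ∣ ℕ.< p
    d<p = ℕ.≤-<-trans (≡.subst (ℕ._≤ m ℕ.⊔ n) (≡.cong ℤ.∣_∣ (≡.sym (ℤ.[+m]-[+n]≡m⊖n m n)))
                               (ℤ.∣m⊝n∣≤m⊔n m n))
                      (ℕ.⊔-pres-<m m<p n<p)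
    small-multiple : ∀ {d} → p ℕ.∣ d → d ℕ.< p → d ≡ 0
    small-multiple {zero}  _   _   = ≡.refl
    small-multiple {suc d} p∣d d<p = ⊥-elim (ℕ.<⇒≱ d<p (ℕ.∣⇒≤ p∣d))

  -- X^(k+1) - 1 has at most k + 1 roots mod p, so one of 1, …, k + 2 is not a root.
  nonroot-of-power-minus-1 : ∀ k → suc (suc k) ℕ.< p → ∃ λ g → ¬ P ∣ g × ¬ P ∣ - + 1 + g ^ suc k
  nonroot-of-power-minus-1 k N<p =
    nonroot (Fin.¬∀⟶∃¬ (suc (suc k)) (λ i → P ∣ eval f (point i)) (λ i → P ∣? eval f (point i))
                        (λ roots → prime∤1 p-prime (∣m⇒∣-m (constant-vanishes roots))))
    where
    f = - + 1 ∷ monomial k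
    point : Fin (suc (suc k)) → ℤ
    point i = + suc (toℕ i)
    point<p : ∀ i → suc (toℕ i) ℕ.< p
    point<p i = ℕ.≤-<-trans (Fin.toℕ<n i) N<p
    distinct : ∀ {i j} → i ≢ j → ¬ P ∣ point i - point j
    distinct {i} {j} i≢j p∣i-j =
      i≢j (Fin.toℕ-injective (ℕ.suc-injective (∣m-n⇒m≡n (point<p i) (point<p j) p∣i-j)))
    constant-vanishes : (∀ i → P ∣ eval f (point i)) → P ∣ - + 1
    constant-vanishes roots = All.head (coefficients-vanish f point distinct roots)
    nonroot : (∃ λ i → ¬ P ∣ eval f (point i)) → ∃ λ g → ¬ P ∣ g × ¬ P ∣ - + 1 + g ^ suc k
    nonroot (i , p∤f[i]) = point i , ∤-between ℕ.z<s (point<p i) , λ p∣g^[k+1]-1 →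
      p∤f[i] (≡.subst (P ∣_) (≡.cong (λ v → - + 1 + point i * v) (≡.sym (eval-monomial k (point i)))) p∣g^[k+1]-1)

  √2-from-nonroot : ∀ e → p ≡ 1 ℕ.+ e ℕ.* 8 →
                    (∃ λ g → ¬ P ∣ g × ¬ P ∣ - + 1 + g ^ (e ℕ.* 4)) → ∃ λ s → s ^ 2 ≡ + 2 mod P
  √2-from-nonroot e p≡1+8e (g , p∤g , p∤u-1) =
    w + w ^ 7 , congruent (≡.subst (P ∣_) (≡.sym (factor w)) (∣m⇒∣m*n _ p∣w⁴+1))
    where
    u = g ^ (e ℕ.* 4)
    g^p≡gu² : g ^ p ≡ g * u ^ 2
    g^p≡gu² = begin
      g ^ p                    ≡⟨ ≡.cong (g ^_) p≡1+8e ⟩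
      g ^ (1 ℕ.+ e ℕ.* 8)      ≡⟨⟩
      g * g ^ (e ℕ.* (4 ℕ.* 2)) ≡⟨ ≡.cong (λ n → g * g ^ n) (ℕ.*-assoc e 4 2) ⟨
      g * g ^ (e ℕ.* 4 ℕ.* 2)  ≡⟨ ≡.cong (g *_) (ℤ.^-*-assoc g (e ℕ.* 4) 2) ⟨
      g * u ^ 2                ∎
      where open ≡-Reasoning
    -- Fermat gives u² ≡ 1, and u ≢ 1 leaves u ≡ -1.
    p∣u+1 : P ∣ u + + 1
    p∣u+1 = ∣-cancelˡ p-prime p∤u-1 (≡.subst (P ∣_) (difference-of-squares u)
              (∣-cancelˡ p-prime p∤g (≡.subst (P ∣_) (factor-g g (u ^ 2))
                (≡.subst (λ x → P ∣ x - g) g^p≡gu² (Congruent.m∣x-y (fermat p-prime g))))))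
      where
      difference-of-squares : ∀ u → u ^ 2 - + 1 ≡ (- + 1 + u) * (u + + 1)
      difference-of-squares = solve 1 (λ u → u :^ 2 :- con (+ 1) := (:- con (+ 1) :+ u) :* (u :+ con (+ 1))) ≡.refl
      factor-g : ∀ g v → g * v - g ≡ g * (v - + 1)
      factor-g = solve-∀
    w = g ^ e
    p∣w⁴+1 : P ∣ w ^ 4 + + 1
    p∣w⁴+1 = ≡.subst (λ x → P ∣ x + + 1) (≡.sym (ℤ.^-*-assoc g e 4)) p∣u+1
    -- w⁴ ≡ -1, so w + w⁷ is w + w⁻¹, whose square is w² + 2 + w⁻² ≡ 2.
    factor : ∀ w → (w + w ^ 7) ^ 2 - + 2 ≡ (w ^ 4 + + 1) * (w ^ 2 * (+ 1 - w ^ 4 + w ^ 8) + + 2 * (w ^ 4 - + 1))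
    factor = solve 1 (λ w → (w :+ w :^ 7) :^ 2 :- con (+ 2)
      := (w :^ 4 :+ con (+ 1)) :* (w :^ 2 :* (con (+ 1) :- w :^ 4 :+ w :^ 8) :+ con (+ 2) :* (w :^ 4 :- con (+ 1)))) ≡.refl

  √2 : p % 8 ≡ 1 → ∃ λ s → s ^ 2 ≡ + 2 mod P
  √2 p%8≡1 = √2-of (p / 8) (≡.trans (ℕ.m≡m%n+[m/n]*n p 8) (≡.cong (ℕ._+ (p / 8) ℕ.* 8) p%8≡1))
    where
    √2-of : ∀ e → p ≡ 1 ℕ.+ e ℕ.* 8 → ∃ λ s → s ^ 2 ≡ + 2 mod P
    √2-of zero       p≡1    = ⊥-elim (ℕ.<⇒≢ (prime>1 p-prime) (≡.sym p≡1))
    -- The exponent is matched by an explicit refl: unifying suc (3 + e′ * 4) with e * 4 directly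
    -- makes Agda unfold the integer powers.
    √2-of e@(suc e′) p≡1+8e = √2-from-nonroot e p≡1+8e
      (≡.subst (λ n → ∃ λ g → ¬ P ∣ g × ¬ P ∣ - + 1 + g ^ n) {suc (3 ℕ.+ e′ ℕ.* 4)} {e ℕ.* 4} ≡.refl
               (nonroot-of-power-minus-1 (3 ℕ.+ e′ ℕ.* 4) N<p))
      where
      N<p : 5 ℕ.+ e′ ℕ.* 4 ℕ.< p
      N<p = ≡.subst (5 ℕ.+ e′ ℕ.* 4 ℕ.<_) (≡.sym p≡1+8e)
              (ℕ.+-mono-≤ (ℕ.m≤m+n 6 3) (ℕ.*-monoʳ-≤ e′ (ℕ.m≤m+n 4 4)))

-- Infinite sets of septuples

infinite-if-injective : ∀ {S : Septuple → Set} (f : ℕ → Septuple) →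
                        (∀ {i j} → f i ≡ f j → i ≡ j) → (∀ k → S (f k)) → Infinite S
infinite-if-injective f f-injective S[f] xs = f (toℕ i) , S[f] (toℕ i) , f[i]∉xs
  where
  -- Among f 0, …, f (length xs) two would share a position in xs.
  not-all-in : ¬ (∀ (i : Fin (suc (length xs))) → f (toℕ i) ∈ xs)
  not-all-in ∈xs with Fin.pigeonhole (ℕ.n<1+n (length xs)) (λ i → Any.index (∈xs i))
  ... | i , j , i<j , same-position = Fin.<⇒≢ i<j (Fin.toℕ-injective (f-injective
    (≡.trans (lookup-index (∈xs i))
             (≡.trans (≡.cong (lookup xs) same-position) (≡.sym (lookup-index (∈xs j)))))))
  witness = Fin.¬∀⟶∃¬ (suc (length xs)) (λ i → f (toℕ i) ∈ xs) (λ i → f (toℕ i) ∈? xs) not-all-in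
  i = proj₁ witness
  f[i]∉xs = proj₂ witness

-- The parametrised septuples and the threefold 𝒳_p

-- The coordinates B, C and E of ParamForm, written once for ℤ and for the polynomial syntax of the
-- ring solvers (whose semantics then unfolds to the same integers).
module Coordinates {A : Set} (plus times minus : A → A → A) (power : A → ℕ → A) (κ : ℤ → A) where

  private
    infixl 6 _⊕_ _⊖_
    infixl 7 _⊗_
    infixr 8 _⊛_
    _⊕_ _⊗_ _⊖_ : A → A → A
    _⊕_ = plus
    _⊗_ = times
    _⊖_ = minus
    _⊛_ : A → ℕ → A
    _⊛_ = power

  B C E : (P lam gam ε₀ δ₀ μ t₀ F₀ : A) → A
  B P lam gam ε₀ δ₀ μ t₀ F₀ =
    κ (+ 2) ⊗ P ⊗ F₀ ⊛ 2 ⊗ (δ₀ ⊖ ε₀ ⊖ μ ⊗ (P ⊗ lam ⊛ 2 ⊕ κ (+ 9) ⊗ gam ⊛ 2))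
      ⊕ (P ⊗ lam ⊛ 2 ⊕ κ (+ 9) ⊗ gam ⊛ 2) ⊗ t₀ ⊗ F₀
  C P lam gam ε₀ δ₀ μ t₀ F₀ =
    κ (+ 2) ⊗ P ⊗ F₀ ⊛ 2 ⊗ (δ₀ ⊕ ε₀ ⊖ μ ⊗ (P ⊗ lam ⊛ 2 ⊖ κ (+ 9) ⊗ gam ⊛ 2))
      ⊕ (P ⊗ lam ⊛ 2 ⊖ κ (+ 9) ⊗ gam ⊛ 2) ⊗ t₀ ⊗ F₀
  E P lam gam ε₀ δ₀ μ t₀ F₀ =
    F₀ ⊗ (κ (+ 2) ⊗ P ⊗ F₀ ⊗ (ε₀ ⊕ κ (+ 9) ⊗ μ ⊗ gam ⊛ 2) ⊖ κ (+ 9) ⊗ gam ⊛ 2 ⊗ t₀)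
       ⊗ (κ (+ 2) ⊗ F₀ ⊗ (δ₀ ⊖ P ⊗ μ ⊗ lam ⊛ 2) ⊕ lam ⊛ 2 ⊗ t₀)

module Poly {n : ℕ} = Coordinates {Polynomial n} _:+_ _:*_ _:-_ _:^_ con

coordB coordC coordE : ℤ → Params → ℤ
coordB P (lam , gam , ε₀ , δ₀ , μ , t₀ , F₀) = Coordinates.B _+_ _*_ _-_ _^_ id P lam gam ε₀ δ₀ μ t₀ F₀
coordC P (lam , gam , ε₀ , δ₀ , μ , t₀ , F₀) = Coordinates.C _+_ _*_ _-_ _^_ id P lam gam ε₀ δ₀ μ t₀ F₀
coordE P (lam , gam , ε₀ , δ₀ , μ , t₀ , F₀) = Coordinates.E _+_ _*_ _-_ _^_ id P lam gam ε₀ δ₀ μ t₀ F₀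

private
  threefold₁ : ∀ P lam gam ε δ μ t F₀ → let ps = lam , gam , ε , δ , μ , t , F₀ in
    coordB P ps ^ 2 - coordC P ps ^ 2 + + 2 * P * coordE P ps * (+ 2 * F₀) ≡ + 0
  threefold₁ = solve 8 (λ P lam gam ε δ μ t F₀ →
    Poly.B P lam gam ε δ μ t F₀ :^ 2 :- Poly.C P lam gam ε δ μ t F₀ :^ 2
      :+ con (+ 2) :* P :* Poly.E P lam gam ε δ μ t F₀ :* (con (+ 2) :* F₀) := con (+ 0)) ≡.refl

  threefold₂ : ∀ P lam gam ε δ μ t F₀ A D → let ps = lam , gam , ε , δ , μ , t , F₀ in
    + 2 * A * coordB P ps - + 2 * coordC P ps * D + P * (+ 2 * F₀) ^ 2
    ≡ coordB P ps * (+ 2 * A - (P * lam ^ 2 - + 9 * gam ^ 2)) - coordC P ps * (+ 2 * D - (P * lam ^ 2 + + 9 * gam ^ 2))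
      - + 4 * P * F₀ ^ 2 * (P * lam ^ 2 * ε + + 9 * gam ^ 2 * δ - + 1)
  threefold₂ = solve 10 (λ P lam gam ε δ μ t F₀ A D →
    con (+ 2) :* A :* Poly.B P lam gam ε δ μ t F₀ :- con (+ 2) :* Poly.C P lam gam ε δ μ t F₀ :* D
      :+ P :* (con (+ 2) :* F₀) :^ 2
    := Poly.B P lam gam ε δ μ t F₀ :* (con (+ 2) :* A :- (P :* lam :^ 2 :- con (+ 9) :* gam :^ 2))
      :- Poly.C P lam gam ε δ μ t F₀ :* (con (+ 2) :* D :- (P :* lam :^ 2 :+ con (+ 9) :* gam :^ 2))
      :- con (+ 4) :* P :* F₀ :^ 2 :* (P :* lam :^ 2 :* ε :+ con (+ 9) :* gam :^ 2 :* δ :- con (+ 1))) ≡.refl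

  threefold₃ : ∀ P lam gam A D →
    + 4 * (A ^ 2 - D ^ 2 + P * (+ 3 * lam * gam) ^ 2)
    ≡ (+ 2 * A + (P * lam ^ 2 - + 9 * gam ^ 2)) * (+ 2 * A - (P * lam ^ 2 - + 9 * gam ^ 2))
      - (+ 2 * D + (P * lam ^ 2 + + 9 * gam ^ 2)) * (+ 2 * D - (P * lam ^ 2 + + 9 * gam ^ 2))
  threefold₃ = solve 5 (λ P lam gam A D →
    con (+ 4) :* (A :^ 2 :- D :^ 2 :+ P :* (con (+ 3) :* lam :* gam) :^ 2)
    := (con (+ 2) :* A :+ (P :* lam :^ 2 :- con (+ 9) :* gam :^ 2)) :* (con (+ 2) :* A :- (P :* lam :^ 2 :- con (+ 9) :* gam :^ 2))
      :- (con (+ 2) :* D :+ (P :* lam :^ 2 :+ con (+ 9) :* gam :^ 2)) :* (con (+ 2) :* D :- (P :* lam :^ 2 :+ con (+ 9) :* gam :^ 2)))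
    ≡.refl

  combination₂-vanishes : ∀ {u v} a b → u ≡ + 0 → v ≡ + 0 → a * u - b * v ≡ + 0
  combination₂-vanishes a b ≡.refl ≡.refl = vanish a b
    where
    vanish : ∀ a b → a * + 0 - b * + 0 ≡ + 0
    vanish = solve-∀

  combination₃-vanishes : ∀ {u v w} a b c → u ≡ + 0 → v ≡ + 0 → w ≡ + 0 → a * u - b * v - c * w ≡ + 0
  combination₃-vanishes a b c ≡.refl ≡.refl ≡.refl = vanish a b c
    where
    vanish : ∀ a b c → a * + 0 - b * + 0 - c * + 0 ≡ + 0
    vanish = solve-∀

paramForm⇒A1 : ∀ {p lam gam ε₀ δ₀ μ t₀ F₀ A B C D E F G} → F₀ ≢ + 0 →
               ParamForm p (lam , gam , ε₀ , δ₀ , μ , t₀ , F₀) (A , B , C , D , E , F , G) →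
               A1 p (A , B , C , D , E , F , G)
paramForm⇒A1 {p} {lam} {gam} {ε₀} {δ₀} {μ} {t₀} {F₀} {A} {D = D} F₀≢0
  (_ , _ , _ , _ , _ , _ , _ , _ , _ , bezout , 2A≡ , ≡.refl , ≡.refl , 2D≡ , ≡.refl , ≡.refl , ≡.refl) =
  F≢0 , threefold₁ (+ p) lam gam ε₀ δ₀ μ t₀ F₀
  , ≡.trans (threefold₂ (+ p) lam gam ε₀ δ₀ μ t₀ F₀ A D)
            (combination₃-vanishes (coordB (+ p) ps) (coordC (+ p) ps) (+ 4 * + p * F₀ ^ 2)
                                   (ℤ.i≡j⇒i-j≡0 2A≡) (ℤ.i≡j⇒i-j≡0 2D≡) (ℤ.i≡j⇒i-j≡0 bezout))
  , ℤ.*-cancelˡ-≡ (+ 4) _ (+ 0) (≡.trans (threefold₃ (+ p) lam gam A D)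
      (combination₂-vanishes (+ 2 * A + (+ p * lam ^ 2 - + 9 * gam ^ 2)) (+ 2 * D + (+ p * lam ^ 2 + + 9 * gam ^ 2))
                             (ℤ.i≡j⇒i-j≡0 2A≡) (ℤ.i≡j⇒i-j≡0 2D≡)))
  where
  ps = lam , gam , ε₀ , δ₀ , μ , t₀ , F₀
  F≢0 : ¬ (_ × _ × _ × _ × _ × + 2 * F₀ ≡ + 0 × _)
  F≢0 (_ , _ , _ , _ , _ , 2F₀≡0 , _) = F₀≢0 (ℤ.*-cancelˡ-≡ (+ 2) F₀ (+ 0) 2F₀≡0)

private
  minors-certificate : ∀ a b c d e f g P →
    let eq₁ = b ^ 2 - c ^ 2 + + 2 * P * e * f
        eq₂ = + 2 * a * b - + 2 * c * d + P * f ^ 2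
        eq₃ = a ^ 2 - d ^ 2 + P * g ^ 2
        m₂ = d * e - c * f
        m₃ = a * e - b * f
    in + 3 * P * f ^ 6 ≡ + 4 * g ^ 2 * f ^ 2 * eq₁ + f * (+ 3 * f ^ 3 - + 2 * g ^ 2 * e) * eq₂ - + 6 * e * f ^ 3 * eq₃
                         + (+ 4 * g ^ 2 * (m₂ - d * e) - + 6 * d * f ^ 3) * m₂ + (+ 6 * a * f ^ 3 + + 4 * g ^ 2 * (a * e - m₃)) * m₃
  minors-certificate = solve 8 (λ a b c d e f g P →
    let eq₁ = b :^ 2 :- c :^ 2 :+ con (+ 2) :* P :* e :* f
        eq₂ = con (+ 2) :* a :* b :- con (+ 2) :* c :* d :+ P :* f :^ 2
        eq₃ = a :^ 2 :- d :^ 2 :+ P :* g :^ 2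
        m₂ = d :* e :- c :* f
        m₃ = a :* e :- b :* f
    in con (+ 3) :* P :* f :^ 6
       := con (+ 4) :* g :^ 2 :* f :^ 2 :* eq₁ :+ f :* (con (+ 3) :* f :^ 3 :- con (+ 2) :* g :^ 2 :* e) :* eq₂
          :- con (+ 6) :* e :* f :^ 3 :* eq₃
          :+ (con (+ 4) :* g :^ 2 :* (m₂ :- d :* e) :- con (+ 6) :* d :* f :^ 3) :* m₂
          :+ (con (+ 6) :* a :* f :^ 3 :+ con (+ 4) :* g :^ 2 :* (a :* e :- m₃)) :* m₃) ≡.refl

minors⇒∣3pf⁶ : ∀ {l p a b c d e f g} → A1 p (a , b , c , d , e , f , g) →
               l ∣ d * e - c * f → l ∣ a * e - b * f → l ∣ + 3 * + p * f ^ 6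
minors⇒∣3pf⁶ {l} {p} {a} {b} {c} {d} {e} {f} {g} (_ , eq₁ , eq₂ , eq₃) l∣m₂ l∣m₃ =
  ≡.subst (l ∣_) (≡.sym (minors-certificate a b c d e f g (+ p)))
    (∣m∣n⇒∣m+n (∣m∣n⇒∣m+n (∣m∣n⇒∣m-n (∣m∣n⇒∣m+n (∣n⇒∣m*n (+ 4 * g ^ 2 * f ^ 2) (vanishes eq₁))
                                                  (∣n⇒∣m*n (f * (+ 3 * f ^ 3 - + 2 * g ^ 2 * e)) (vanishes eq₂)))
                                      (∣n⇒∣m*n (+ 6 * e * f ^ 3) (vanishes eq₃)))
                          (∣n⇒∣m*n (+ 4 * g ^ 2 * (m₂ - d * e) - + 6 * d * f ^ 3) l∣m₂))
               (∣n⇒∣m*n (+ 6 * a * f ^ 3 + + 4 * g ^ 2 * (a * e - m₃)) l∣m₃))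
  where
  m₂ = d * e - c * f
  m₃ = a * e - b * f
  vanishes : ∀ {x} → x ≡ + 0 → l ∣ x
  vanishes ≡.refl = Modulo.m∣0 l

-- Residues modulo 3

module _ where
  open Modulo (+ 3)
  -- Coefficients divisible by 3 are dropped, but constants are not reduced: the residues below
  -- are whatever constant terms the solver produces (32 ≡ 8 ≡ 2).
  module ℤ/3 = Simple-Solver (ACR.fromCommutativeRing commutativeRing)
                 (λ x y → Dec.map′ congruent Congruent.m∣x-y (+ 3 ∣? x - y))
  module Poly₃ {n : ℕ} = Coordinates {ℤ/3.Polynomial n} ℤ/3._:+_ ℤ/3._:*_ ℤ/3._:-_ ℤ/3._:^_ ℤ/3.con

  private
    one : ∀ {n} → ℤ/3.Polynomial n
    one = ℤ/3.con (+ 1)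
    1+3_ 2+3_ : ∀ {n} → ℤ/3.Polynomial n → ℤ/3.Polynomial n
    1+3 q = ℤ/3.con (+ 1) ℤ/3.:+ ℤ/3.con (+ 3) ℤ/3.:* q
    2+3 q = ℤ/3.con (+ 2) ℤ/3.:+ ℤ/3.con (+ 3) ℤ/3.:* q

  -- Substituting p = 2 + 3a, λ = 2 + 3b, ε = 2 + 3c, t = 1 + 3τ and μ = -δ + 3k.
  private
    E-residue : ∀ a b c τ k δ →
      coordE (+ 2 + + 3 * a) (+ 2 + + 3 * b , + 1 , + 2 + + 3 * c , δ , - δ + + 3 * k , + 1 + + 3 * τ , + 1) ≡ + 32 mod + 3
    E-residue = ℤ/3.solve 6 (λ a b c τ k δ →
      Poly₃.E (2+3 a) (2+3 b) one (2+3 c) δ (ℤ/3.:- δ ℤ/3.:+ ℤ/3.con (+ 3) ℤ/3.:* k) (1+3 τ) one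
      ℤ/3.:= ℤ/3.con (+ 32)) ≈-refl

    B-residue : ∀ a b c τ k δ →
      (+ 2 + + 3 * a) * (+ 2 + + 3 * b) ^ 2 - + 9
        + + 2 * coordB (+ 2 + + 3 * a) (+ 2 + + 3 * b , + 1 , + 2 + + 3 * c , δ , - δ + + 3 * k , + 1 + + 3 * τ , + 1)
      ≡ + 8 mod + 3
    B-residue = ℤ/3.solve 6 (λ a b c τ k δ →
      2+3 a ℤ/3.:* (2+3 b) ℤ/3.:^ 2 ℤ/3.:- ℤ/3.con (+ 9)
        ℤ/3.:+ ℤ/3.con (+ 2)
          ℤ/3.:* Poly₃.B (2+3 a) (2+3 b) one (2+3 c) δ (ℤ/3.:- δ ℤ/3.:+ ℤ/3.con (+ 3) ℤ/3.:* k) (1+3 τ) one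
      ℤ/3.:= ℤ/3.con (+ 8)) ≈-refl

    ε-residue : ∀ a b ε δ → ε - + 2 - (+ 2 * ((+ 2 + + 3 * a) * (+ 2 + + 3 * b) ^ 2 * ε + + 9 * δ) - + 2) ≡ + 0 mod + 3
    ε-residue = ℤ/3.solve 4 (λ a b ε δ →
      ε ℤ/3.:- ℤ/3.con (+ 2)
        ℤ/3.:- (ℤ/3.con (+ 2) ℤ/3.:* (2+3 a ℤ/3.:* (2+3 b) ℤ/3.:^ 2 ℤ/3.:* ε ℤ/3.:+ ℤ/3.con (+ 9) ℤ/3.:* δ)
                ℤ/3.:- ℤ/3.con (+ 2))
      ℤ/3.:= ℤ/3.con (+ 0)) ≈-refl

  bezout⇒ε≡2[3] : ∀ {P lam ε δ} → P ≡ + 2 mod + 3 → lam ≡ + 2 mod + 3 →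
                  P * lam ^ 2 * ε + + 9 * δ ≡ + 1 → ε ≡ + 2 mod + 3
  bezout⇒ε≡2[3] {ε = ε} {δ} P≡2 lam≡2 bezout with ≈⇒≡+multiple P≡2 | ≈⇒≡+multiple lam≡2
  ... | a , ≡.refl | b , ≡.refl = congruent (≡.subst (+ 3 ∣_) (ℤ.+-identityʳ (ε - + 2))
    (≈0⇒∣ (≡.subst (λ z → ε - + 2 - (+ 2 * z - + 2) ≡ + 0 mod + 3) bezout (ε-residue a b ε δ))))

  coordE≢0[3] : ∀ {P lam ε δ μ t} → P ≡ + 2 mod + 3 → lam ≡ + 2 mod + 3 → ε ≡ + 2 mod + 3 →
                t ≡ + 1 mod + 3 → μ ≡ - δ mod + 3 → ¬ + 3 ∣ coordE P (lam , + 1 , ε , δ , μ , t , + 1)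
  coordE≢0[3] {δ = δ} P≡2 lam≡2 ε≡2 t≡1 μ≡-δ
    with ≈⇒≡+multiple P≡2 | ≈⇒≡+multiple lam≡2 | ≈⇒≡+multiple ε≡2 | ≈⇒≡+multiple t≡1 | ≈⇒≡+multiple μ≡-δ
  ... | a , ≡.refl | b , ≡.refl | c , ≡.refl | τ , ≡.refl | k , ≡.refl =
    λ 3∣E → from-no (+ 3 ∣? + 32) (∣-respʳ-≈ (E-residue a b c τ k δ) 3∣E)

  A+coordB≢0[3] : ∀ {P lam ε δ μ t A} → P ≡ + 2 mod + 3 → lam ≡ + 2 mod + 3 → ε ≡ + 2 mod + 3 →
                  t ≡ + 1 mod + 3 → μ ≡ - δ mod + 3 → + 2 * A ≡ P * lam ^ 2 - + 9 →
                  ¬ + 3 ∣ A + coordB P (lam , + 1 , ε , δ , μ , t , + 1)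
  A+coordB≢0[3] {δ = δ} {A = A} P≡2 lam≡2 ε≡2 t≡1 μ≡-δ half-A
    with ≈⇒≡+multiple P≡2 | ≈⇒≡+multiple lam≡2 | ≈⇒≡+multiple ε≡2 | ≈⇒≡+multiple t≡1 | ≈⇒≡+multiple μ≡-δ
  ... | a , ≡.refl | b , ≡.refl | c , ≡.refl | τ , ≡.refl | k , ≡.refl = λ 3∣A+B →
    from-no (+ 3 ∣? + 8) (∣-respʳ-≈ (B-residue a b c τ k δ)
      (≡.subst (+ 3 ∣_) (≡.trans (ℤ.*-distribˡ-+ (+ 2) A _) (≡.cong (_+ _) half-A)) (∣n⇒∣m*n (+ 2) 3∣A+B)))

-- Admissible parameters give good septuples

record Admissible (p : ℕ) (lam ε δ t A : ℤ) : Set where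
  field
    half-A        : + 2 * A ≡ + p * lam ^ 2 - + 9
    bezout        : + p * lam ^ 2 * ε + + 9 * δ ≡ + 1
    lam-odd       : Odd lam
    lam≡2[3]      : lam ≡ + 2 mod + 3
    t≡1[3]        : t ≡ + 1 mod + 3
    324t≡-1       : + 324 * t ≡ - + 1 mod + p
    [lam+24]²≡648 : (lam + + 24) ^ 2 ≡ + 648 mod + p

module Construction {p : ℕ} (p-prime : Prime p) (p%3≡2 : p % 3 ≡ 2)
                    {lam ε δ t A : ℤ} (admissible : Admissible p lam ε δ t A) where

  open Admissible admissible

  private
    P = + p

  params : ℤ → Params
  params μ = lam , + 1 , ε , δ , μ , t , + 1

  septuple : ℤ → Septuple
  septuple μ = A , coordB P (params μ) , coordC P (params μ) , A + + 9 , coordE P (params μ) , + 2 , + 3 * lam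

  P≡2[3] : P ≡ + 2 mod + 3
  P≡2[3] = Modulo.multiple⇒≈ (+ 3) (+ (p / 3)) (quotient-remainder p%3≡2)

  3∤p : ¬ 3 ℕ.∣ p
  3∤p 3∣p = from-no (+ 3 ∣? + 2) (Modulo.∣-respʳ-≈ (+ 3) P≡2[3] (∣ᵤ⇒∣ 3∣p))

  3∤lam : ¬ + 3 ∣ lam
  3∤lam 3∣lam = from-no (+ 3 ∣? + 2) (Modulo.∣-respʳ-≈ (+ 3) lam≡2[3] 3∣lam)

  p∤3 : ¬ P ∣ + 3
  p∤3 p∣3 = prime∤1 p-prime (≡.subst (P ∣_) bezout
    (∣m∣n⇒∣m+n (∣m⇒∣m*n ε (∣m⇒∣m*n (lam ^ 2) ∣-refl)) (∣m⇒∣m*n δ (∣n⇒∣m*n (+ 3) p∣3))))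

  p∤2 : ¬ P ∣ + 2
  p∤2 p∣2 = ∤-* p-prime p∤3 p∤3
    (≡.subst (P ∣_) nine (∣m∣n⇒∣m-n (∣m⇒∣m*n (lam ^ 2) ∣-refl) (∣m⇒∣m*n A p∣2)))
    where
    cancel : ∀ x → x - (x - + 9) ≡ + 9
    cancel = solve-∀
    nine : P * lam ^ 2 - + 2 * A ≡ + 9
    nine = ≡.trans (≡.cong (λ y → P * lam ^ 2 - y) half-A) (cancel (P * lam ^ 2))

  p∤lam : ¬ P ∣ lam
  p∤lam p∣lam = ∤-* p-prime p∤2 (∤-* p-prime p∤2 (∤-* p-prime p∤2 (∤-* p-prime p∤3 p∤3)))
    (≡.subst (P ∣_) (seventy-two lam)
      (∣m∣n⇒∣m-n (∣m⇒∣m*n (lam + + 48) p∣lam) (Congruent.m∣x-y [lam+24]²≡648)))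
    where
    seventy-two : ∀ x → x * (x + + 48) - ((x + + 24) ^ 2 - + 648) ≡ + 72
    seventy-two = solve 1 (λ x → x :* (x :+ con (+ 48)) :- ((x :+ con (+ 24)) :^ 2 :- con (+ 648)) := con (+ 72)) ≡.refl

  ε≢0 : ε ≢ + 0
  ε≢0 ε≡0 = from-no (+ 3 ∣? + 1) (≡.subst (+ 3 ∣_) (≡.trans (≡.sym (drop (P * lam ^ 2) (+ 9 * δ)))
              (≡.subst (λ e → P * lam ^ 2 * e + + 9 * δ ≡ + 1) ε≡0 bezout)) (∣m⇒∣m*n δ (∣n⇒∣m*n (+ 3) ∣-refl)))
    where
    drop : ∀ x y → x * + 0 + y ≡ y
    drop = solve-∀

  δ≢0 : δ ≢ + 0
  δ≢0 δ≡0 = prime∤1 p-prime (≡.subst (P ∣_) (≡.trans (≡.sym (drop (P * lam ^ 2 * ε)))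
              (≡.subst (λ d → P * lam ^ 2 * ε + + 9 * d ≡ + 1) δ≡0 bezout))
              (∣m⇒∣m*n ε (∣m⇒∣m*n (lam ^ 2) ∣-refl)))
    where
    drop : ∀ x → x + + 9 * + 0 ≡ x
    drop = solve-∀

  half-D : + 2 * (A + + 9) ≡ P * lam ^ 2 + + 9
  half-D = begin
    + 2 * (A + + 9)        ≡⟨ distribute A ⟩
    + 2 * A + + 18         ≡⟨ ≡.cong (_+ + 18) half-A ⟩
    P * lam ^ 2 - + 9 + + 18 ≡⟨ simplify (P * lam ^ 2) ⟩
    P * lam ^ 2 + + 9      ∎
    where
    open ≡-Reasoning
    distribute : ∀ a → + 2 * (a + + 9) ≡ + 2 * a + + 18
    distribute = solve-∀
    simplify : ∀ x → x - + 9 + + 18 ≡ x + + 9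
    simplify = solve-∀

  paramForm : ∀ μ → ParamForm p (params μ) (septuple μ)
  paramForm μ =
      (λ lam≡0 → p∤lam (≡.subst (P ∣_) (≡.sym lam≡0) (Modulo.m∣0 P))) , (λ ()) , lam-odd
    , (λ 2∣1 → from-no (+ 2 ∣? + 1) (∣ᵤ⇒∣ 2∣1))
    , ≡.cong +_ (prime∤⇒gcd≡1 prime[3] (λ 3∣lam → 3∤lam (∣ᵤ⇒∣ 3∣lam)))
    , ≡.cong +_ (prime∤⇒gcd≡1 prime[3] 3∤p)
    , ≡.cong +_ (≡.trans (ℕ.gcd-comm p _) (prime∤⇒gcd≡1 p-prime (λ p∣lam → p∤lam (∣ᵤ⇒∣ p∣lam))))
    , ε≢0 , δ≢0 , bezout , half-A , ≡.refl , ≡.refl , half-D , ≡.refl , ≡.refl , ≡.sym (ℤ.*-identityʳ (+ 3 * lam))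
    where
    prime[3] : Prime 3
    prime[3] = from-yes (prime? 3)

  private
    E-split : ∀ P lam ε δ μ t → coordE P (lam , + 1 , ε , δ , μ , t , + 1)
              ≡ (P * (+ 2 * (ε + + 9 * μ)) + - (+ 9 * t)) * (P * - (+ 2 * μ * lam ^ 2) + (+ 2 * δ + lam ^ 2 * t))
    E-split = solve 6 (λ P lam ε δ μ t →
      Poly.E P lam (con (+ 1)) ε δ μ t (con (+ 1))
      := (P :* (con (+ 2) :* (ε :+ con (+ 9) :* μ)) :+ :- (con (+ 9) :* t))
         :* (P :* :- (con (+ 2) :* μ :* lam :^ 2) :+ (con (+ 2) :* δ :+ lam :^ 2 :* t))) ≡.refl

    B-split : ∀ P lam ε δ μ t → coordB P (lam , + 1 , ε , δ , μ , t , + 1)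
              ≡ P * (+ 2 * (δ - ε - μ * (P * lam ^ 2 + + 9)) + lam ^ 2 * t) + + 9 * t
    B-split = solve 6 (λ P lam ε δ μ t →
      Poly.B P lam (con (+ 1)) ε δ μ t (con (+ 1))
      := P :* (con (+ 2) :* (δ :- ε :- μ :* (P :* lam :^ 2 :+ con (+ 9))) :+ lam :^ 2 :* t) :+ con (+ 9) :* t) ≡.refl

    -- 3λ - 729 E₀ vanishes mod p as a combination of 324t + 1, 9δ - 1 and (λ + 24)² - 648.
    729E₀-certificate : ∀ lam t δ →
      + 16 * (+ 3 * lam - - (+ 9 * t) * (+ 2 * δ + lam ^ 2 * t) * + 729)
      ≡ (- lam ^ 2 + + 324 * lam ^ 2 * t + + 648 * δ) * (+ 324 * t + + 1) - + 72 * (+ 9 * δ - + 1) + ((lam + + 24) ^ 2 - + 648)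
    729E₀-certificate = solve 3 (λ lam t δ →
      con (+ 16) :* (con (+ 3) :* lam :- :- (con (+ 9) :* t) :* (con (+ 2) :* δ :+ lam :^ 2 :* t) :* con (+ 729))
      := (:- lam :^ 2 :+ con (+ 324) :* lam :^ 2 :* t :+ con (+ 648) :* δ) :* (con (+ 324) :* t :+ con (+ 1))
         :- con (+ 72) :* (con (+ 9) :* δ :- con (+ 1)) :+ ((lam :+ con (+ 24)) :^ 2 :- con (+ 648))) ≡.refl

  open Modulo P

  9δ≡1 : + 9 * δ ≡ + 1 mod P
  9δ≡1 = ≈-trans (≈-sym (+-absorbˡ (+ 9 * δ) (∣m⇒∣m*n ε (∣m⇒∣m*n (lam ^ 2) ∣-refl)))) (≈-reflexive bezout)

  E≡E₀ : ∀ μ → coordE P (params μ) ≡ - (+ 9 * t) * (+ 2 * δ + lam ^ 2 * t) mod P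
  E≡E₀ μ = ≈-trans (≈-reflexive (E-split P lam ε δ μ t))
                   (*-cong (+-absorbˡ _ (∣m⇒∣m*n _ ∣-refl)) (+-absorbˡ _ (∣m⇒∣m*n _ ∣-refl)))

  3λ≡729E : ∀ μ → + 3 * lam ≡ coordE P (params μ) * + 729 mod P
  3λ≡729E μ = ≈-trans (congruent p∣3λ-729E₀) (*-cong (≈-sym (E≡E₀ μ)) ≈-refl)
    where
    p∣3λ-729E₀ : P ∣ + 3 * lam - - (+ 9 * t) * (+ 2 * δ + lam ^ 2 * t) * + 729
    p∣3λ-729E₀ = ∣-cancelˡ p-prime (∤-* p-prime p∤2 (∤-* p-prime p∤2 (∤-* p-prime p∤2 p∤2)))
      (≡.subst (P ∣_) (≡.sym (729E₀-certificate lam t δ))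
        (∣m∣n⇒∣m+n (∣m∣n⇒∣m-n (∣n⇒∣m*n (- lam ^ 2 + + 324 * lam ^ 2 * t + + 648 * δ) (Congruent.m∣x-y 324t≡-1))
                              (∣n⇒∣m*n (+ 72) (Congruent.m∣x-y 9δ≡1)))
                   (Congruent.m∣x-y [lam+24]²≡648)))

  p∤G : ¬ P ∣ + 3 * lam
  p∤G = ∤-* p-prime p∤3 p∤lam

  p∤E : ∀ μ → ¬ P ∣ coordE P (params μ)
  p∤E μ p∣E = p∤G (∣-respʳ-≈ (≈-sym (3λ≡729E μ)) (∣m⇒∣m*n (+ 729) p∣E))

  B≡9t : ∀ μ → coordB P (params μ) ≡ + 9 * t mod P
  B≡9t μ = ≈-trans (≈-reflexive (B-split P lam ε δ μ t)) (+-absorbˡ _ (∣m⇒∣m*n _ ∣-refl))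

  -- That is, N ≡ -3·(3/2)², which x²+3c²≢0 shows is not a square.
  4N+27≡0 : ∀ {N} → N ≡ A + + 729 * t mod P → + 4 * N + + 27 ≡ + 0 mod P
  4N+27≡0 {N} N≈ = begin
    + 4 * N + + 27                              ≈⟨ +-cong (*-cong (≈-refl {+ 4}) N≈) (≈-refl {+ 27}) ⟩
    + 4 * (A + + 729 * t) + + 27                ≡⟨ regroup A t ⟩
    + 2 * (+ 2 * A) + + 9 * (+ 324 * t) + + 27  ≈⟨ +-cong (+-cong (≈-reflexive (≡.cong (+ 2 *_) half-A))
                                                                  (*-cong (≈-refl {+ 9}) 324t≡-1)) (≈-refl {+ 27}) ⟩
    + 2 * (P * lam ^ 2 - + 9) + + 9 * - + 1 + + 27 ≡⟨ simplify P (lam ^ 2) ⟩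
    P * (+ 2 * lam ^ 2)                         ≈⟨ ∣⇒≈0 (∣m⇒∣m*n _ ∣-refl) ⟩
    + 0                                         ∎
    where
    open ≈-Reasoning
    regroup : ∀ a t → + 4 * (a + + 729 * t) + + 27 ≡ + 2 * (+ 2 * a) + + 9 * (+ 324 * t) + + 27
    regroup = solve-∀
    simplify : ∀ P x → + 2 * (P * x - + 9) + + 9 * - + 1 + + 27 ≡ P * (+ 2 * x)
    simplify = solve-∀

  qnr : ∀ μ ζ → + p ℤU.∣ ζ ^ 3 - + 1 → QNR p (A + ζ * coordB P (params μ) * (+ 3) ^ 4)
  qnr μ ζ p∣ζ³-1 =
      (λ p∣N → p∤27 (∣m+n∣m⇒∣n {P} {+ 4 * N} {+ 27} (≈0⇒∣ 4N+27≈0) (∣n⇒∣m*n (+ 4) (∣ᵤ⇒∣ {P} {N} p∣N))))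
    , no-square-root
    where
    open ≈-Reasoning
    B = coordB P (params μ)
    N = A + ζ * B * + 81
    ζ≡1 : ζ ≡ + 1 mod P
    ζ≡1 = cube-injective p-prime p%3≡2 {ζ} {+ 1} (congruent (∣ᵤ⇒∣ {P} {ζ ^ 3 - + 1} p∣ζ³-1))
    4N+27≈0 : + 4 * N + + 27 ≡ + 0 mod P
    4N+27≈0 = 4N+27≡0 (≈-trans (+-cong (≈-refl {A}) (*-cong (*-cong ζ≡1 (B≡9t μ)) (≈-refl {+ 81})))
                                (≈-reflexive (collect A t)))
      where
      collect : ∀ a t → a + + 1 * (+ 9 * t) * + 81 ≡ a + + 729 * t
      collect = solve-∀
    p∤27 : ¬ P ∣ + 27
    p∤27 = ∤-* p-prime p∤3 (∤-* p-prime p∤3 p∤3)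
    no-square-root : ¬ ∃ λ x → + p ℤU.∣ x ^ 2 - N
    no-square-root (x , p∣x²-N) = x²+3c²≢0 p-prime p%3≡2 {+ 2 * x} {+ 3} p∤2 p∤3 p∤3 (begin
      (+ 2 * x) ^ 2 + + 3 * (+ 3) ^ 2 ≡⟨ expand x ⟩
      + 4 * x ^ 2 + + 27              ≈⟨ +-cong (*-cong (≈-refl {+ 4}) x²≡N) (≈-refl {+ 27}) ⟩
      + 4 * N + + 27                  ≈⟨ 4N+27≈0 ⟩
      + 0                             ∎)
      where
      x²≡N : x ^ 2 ≡ N mod P
      x²≡N = congruent (∣ᵤ⇒∣ p∣x²-N)
      expand : ∀ x → (+ 2 * x) ^ 2 + + 3 * (+ 3) ^ 2 ≡ + 4 * x ^ 2 + + 27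
      expand = solve 1 (λ x → (con (+ 2) :* x) :^ 2 :+ con (+ 3) :* con (+ 3) :^ 2
                              := con (+ 4) :* x :^ 2 :+ con (+ 27)) ≡.refl

  ε≡2[3] : ε ≡ + 2 mod + 3
  ε≡2[3] = bezout⇒ε≡2[3] P≡2[3] lam≡2[3] bezout

  A1-holds : ∀ μ → A1 p (septuple μ)
  A1-holds μ = paramForm⇒A1 {p} {lam} {+ 1} {ε} {δ} {μ} {t} {+ 1} (λ ()) (paramForm μ)

  A3-holds : ∀ μ → A3 p (septuple μ)
  A3-holds μ = ≡.trans (≡.cong (λ g → ℤ.gcd g (+ 3 * lam)) gcd[A,D]≡1) (ℤ.gcd-zeroˡ (+ 3 * lam))
             , (λ p∣E → p∤E μ (∣ᵤ⇒∣ {P} {coordE P (params μ)} p∣E))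
             , (λ p∣G → p∤G (∣ᵤ⇒∣ {P} {+ 3 * lam} p∣G))
    where
    -- A common divisor of A and D = A + 9 divides (A + D) ε + (D - A) δ = p λ² ε + 9 δ = 1.
    combination : (A + (A + + 9)) * ε + ((A + + 9) - A) * δ ≡ + 1
    combination = begin
      (A + (A + + 9)) * ε + ((A + + 9) - A) * δ ≡⟨ regroup A ε δ ⟩
      (+ 2 * A + + 9) * ε + + 9 * δ             ≡⟨ ≡.cong (λ y → (y + + 9) * ε + + 9 * δ) half-A ⟩
      (P * lam ^ 2 - + 9 + + 9) * ε + + 9 * δ   ≡⟨ simplify (P * lam ^ 2) ε δ ⟩
      P * lam ^ 2 * ε + + 9 * δ                 ≡⟨ bezout ⟩
      + 1                                       ∎
      where
      open ≡-Reasoning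
      regroup : ∀ a ε δ → (a + (a + + 9)) * ε + ((a + + 9) - a) * δ ≡ (+ 2 * a + + 9) * ε + + 9 * δ
      regroup = solve-∀
      simplify : ∀ x ε δ → (x - + 9 + + 9) * ε + + 9 * δ ≡ x * ε + + 9 * δ
      simplify = solve-∀
    g : ℤ
    g = ℤ.gcd A (A + + 9)
    g∣1 : g ∣ + 1
    g∣1 = ≡.subst (g ∣_) combination
      (∣m∣n⇒∣m+n (∣m⇒∣m*n ε (∣m∣n⇒∣m+n g∣A g∣D)) (∣m⇒∣m*n δ (∣m∣n⇒∣m-n g∣D g∣A)))
      where
      g∣A : g ∣ A
      g∣A = ∣ᵤ⇒∣ (ℤ.gcd[i,j]∣i A (A + + 9))
      g∣D : g ∣ A + + 9
      g∣D = ∣ᵤ⇒∣ (ℤ.gcd[i,j]∣j A (A + + 9))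
    gcd[A,D]≡1 : g ≡ + 1
    gcd[A,D]≡1 = ≡.cong +_ (ℕ.∣1⇒≡1 (∣⇒∣ᵤ g∣1))

  -- Vacuously: a prime l as in (A4) would divide 3p·2⁶.
  A4-holds : ∀ μ → A4 p (septuple μ)
  A4-holds μ l l-prime l≢2 gcd[l,3]≡1 gcd[l,p]≡1 l∣minors =
    ⊥-elim (l∤3p2⁶ (minors⇒∣3pf⁶ {+ l} {p} {A} {B} {C} {A + + 9} {E} {+ 2} {+ 3 * lam} (A1-holds μ)
                                 (∣ᵤ⇒∣ {+ l} {m₂} l∣m₂) (∣ᵤ⇒∣ {+ l} {m₃} l∣m₃)))
    where
    B = coordB P (params μ)
    C = coordC P (params μ)
    E = coordE P (params μ)
    m₁ = A * C - B * (A + + 9)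
    m₂ = (A + + 9) * E - C * + 2
    m₃ = A * E - B * + 2
    l∣m₂ : l ℕ.∣ ℤ.∣ m₂ ∣
    l∣m₂ = ℕ.∣-trans l∣minors
             (ℕ.∣-trans (ℕ.gcd[m,n]∣m (ℕ.gcd ℤ.∣ m₁ ∣ ℤ.∣ m₂ ∣) ℤ.∣ m₃ ∣) (ℕ.gcd[m,n]∣n ℤ.∣ m₁ ∣ ℤ.∣ m₂ ∣))
    l∣m₃ : l ℕ.∣ ℤ.∣ m₃ ∣
    l∣m₃ = ℕ.∣-trans l∣minors (ℕ.gcd[m,n]∣n (ℕ.gcd ℤ.∣ m₁ ∣ ℤ.∣ m₂ ∣) ℤ.∣ m₃ ∣)
    coprime-∤ : ∀ {n} → ℕ.gcd l n ≡ 1 → ¬ + l ∣ + n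
    coprime-∤ gcd≡1 l∣n = ℕ.<⇒≢ (prime>1 l-prime)
      (≡.sym (ℕ.∣1⇒≡1 (≡.subst (l ℕ.∣_) gcd≡1 (ℕ.gcd-greatest ℕ.∣-refl (∣⇒∣ᵤ l∣n)))))
    l∤2 : ¬ + l ∣ + 2
    l∤2 l∣2 = l≢2 (ℕ.≤-antisym (ℕ.∣⇒≤ (∣⇒∣ᵤ l∣2)) (prime>1 l-prime))
    l∤3p2⁶ : ¬ + l ∣ + 3 * P * (+ 2) ^ 6
    l∤3p2⁶ = ∤-* l-prime (∤-* l-prime (coprime-∤ gcd[l,3]≡1) (coprime-∤ gcd[l,p]≡1))
                         (λ l∣2⁶ → l∤2 (∣^⇒∣ l-prime 5 l∣2⁶))

  A5-holds : ∀ μ → A5 p (septuple μ)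
  A5-holds μ = + 3 , ∣⇒∣ᵤ (Congruent.m∣x-y (3λ≡729E μ)) , qnr μ

  module _ (μ : ℤ) (μ≡-δ : μ ≡ - δ mod + 3) where

    3∤E : ¬ + 3 ∣ coordE P (params μ)
    3∤E = coordE≢0[3] P≡2[3] lam≡2[3] ε≡2[3] t≡1[3] μ≡-δ

    3∣G : + 3 ℤU.∣ + 3 * lam
    3∣G = ∣⇒∣ᵤ (∣m⇒∣m*n {+ 3} {+ 3} lam ∣-refl)

    A6-holds : ∀ n → 1 ℕ.≤ n → A6 p n (septuple μ)
    A6-holds n _ = 0 , 1 , (ℕ.1∣ _ , λ 3∣E → 3∤E (∣ᵤ⇒∣ 3∣E))
                 , (3∣G , λ 9∣G → 3∤lam (∣ᵤ⇒∣ (ℤU.*-cancelˡ-∣ (+ 3) {+ 3} {lam} 9∣G))) , ℤ.-<+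

    A7-holds : A7 (septuple μ)
    A7-holds = (λ 3∣A+B → A+coordB≢0[3] P≡2[3] lam≡2[3] ε≡2[3] t≡1[3] μ≡-δ half-A (∣ᵤ⇒∣ 3∣A+B)) , 3∣G

    good : Good p (septuple μ)
    good = (params μ , paramForm μ) , A1-holds μ , A3-holds μ , A4-holds μ , A5-holds μ , A7-holds , A6-holds

-- Choice of the parameters

module Parameters {p : ℕ} (p-prime : Prime p) (p%8≡1 : p % 8 ≡ 1) (p%3≡2 : p % 3 ≡ 2) where

  private
    P = + p
    e = + (p / 8)
    a = + (p / 3)

    P≡1+8e : P ≡ + 1 + e * + 8
    P≡1+8e = quotient-remainder p%8≡1

    P≡2+3a : P ≡ + 2 + a * + 3
    P≡2+3a = quotient-remainder p%3≡2

  s : ℤ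
  s = proj₁ (√2 p-prime p%8≡1)

  -- λ ≡ 18√2 - 24 (mod p), made odd and ≡ 2 (mod 3) by adding p.
  lam : ℤ
  lam = + 18 * s - + 24 + P

  private
    r = + 9 * s - + 12 + + 4 * e

    lam≡2r+1 : lam ≡ + 2 * r + + 1
    lam≡2r+1 = ≡.trans (≡.cong (λ Q → + 18 * s - + 24 + Q) P≡1+8e) (odd-form s e)
      where
      odd-form : ∀ s e → + 18 * s - + 24 + (+ 1 + e * + 8) ≡ + 2 * (+ 9 * s - + 12 + + 4 * e) + + 1
      odd-form = solve-∀

  A : ℤ
  A = + 4 * e * (+ 2 * r + + 1) ^ 2 + + 2 * r ^ 2 + + 2 * r - + 4

  private
    module M₃ = Modulo (+ 3)

    P≡2[3] : P ≡ + 2 mod + 3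
    P≡2[3] = M₃.multiple⇒≈ a P≡2+3a

    lam≡2[3] : lam ≡ + 2 mod + 3
    lam≡2[3] = M₃.multiple⇒≈ (+ 6 * s - + 8 + a)
                 (≡.trans (≡.cong (λ Q → + 18 * s - + 24 + Q) P≡2+3a) (residue s a))
      where
      residue : ∀ s a → + 18 * s - + 24 + (+ 2 + a * + 3) ≡ + 2 + (+ 6 * s - + 8 + a) * + 3
      residue = solve-∀

    pλ²≡2[3] : P * lam ^ 2 ≡ + 2 mod + 3
    pλ²≡2[3] = M₃.≈-trans (M₃.*-cong P≡2[3] (M₃.^-cong 2 lam≡2[3])) (M₃.multiple⇒≈ (+ 2) ≡.refl)

    q = proj₁ (M₃.≈⇒≡+multiple pλ²≡2[3])

  -- Since pλ² = 2 + 3q, the Bézout relation pλ² ε + 9 δ = 1 has an explicit solution.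
  ε δ : ℤ
  ε = + 6 * q + + 5
  δ = - (+ 2 * q ^ 2 + + 3 * q + + 1)

  -- t ≡ -1/324 (mod p) and t ≡ 1 (mod 3), using 1/2 ≡ (p + 1)/2 = 4e + 1 and 1/3 ≡ (p + 1)/3 = a + 1.
  private
    X = - ((+ 4 * e + + 1) ^ 2 * (a + + 1) ^ 4)

  t : ℤ
  t = (P + + 1) * X - P

  private
    half-A : + 2 * A ≡ P * lam ^ 2 - + 9
    half-A = ≡.trans (halve e r) (≡.sym (≡.cong₂ (λ Q L → Q * L ^ 2 - + 9) P≡1+8e lam≡2r+1))
      where
      halve : ∀ e r → + 2 * (+ 4 * e * (+ 2 * r + + 1) ^ 2 + + 2 * r ^ 2 + + 2 * r - + 4)
                      ≡ (+ 1 + e * + 8) * (+ 2 * r + + 1) ^ 2 - + 9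
      halve = solve 2 (λ e r →
        con (+ 2) :* (con (+ 4) :* e :* (con (+ 2) :* r :+ con (+ 1)) :^ 2 :+ con (+ 2) :* r :^ 2
                      :+ con (+ 2) :* r :- con (+ 4))
        := (con (+ 1) :+ e :* con (+ 8)) :* (con (+ 2) :* r :+ con (+ 1)) :^ 2 :- con (+ 9)) ≡.refl

    bezout : P * lam ^ 2 * ε + + 9 * δ ≡ + 1
    bezout = ≡.trans (≡.cong (λ x → x * ε + + 9 * δ) (proj₂ (M₃.≈⇒≡+multiple pλ²≡2[3]))) (solution q)
      where
      solution : ∀ q → (+ 2 + + 3 * q) * (+ 6 * q + + 5) + + 9 * - (+ 2 * q ^ 2 + + 3 * q + + 1) ≡ + 1
      solution = solve 1 (λ q →
        (con (+ 2) :+ con (+ 3) :* q) :* (con (+ 6) :* q :+ con (+ 5))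
          :+ con (+ 9) :* :- (con (+ 2) :* q :^ 2 :+ con (+ 3) :* q :+ con (+ 1))
        := con (+ 1)) ≡.refl

    lam-odd : Odd lam
    lam-odd 2∣lam = from-no (+ 2 ∣? + 1)
      (≡.subst (+ 2 ∣_) (cancel r) (∣m∣n⇒∣m-n (≡.subst (+ 2 ∣_) lam≡2r+1 (∣ᵤ⇒∣ 2∣lam)) (∣m⇒∣m*n r ∣-refl)))
      where
      cancel : ∀ r → + 2 * r + + 1 - + 2 * r ≡ + 1
      cancel = solve-∀

    t≡1[3] : t ≡ + 1 mod + 3
    t≡1[3] = M₃.multiple⇒≈ ((a + + 1) * (X - + 1))
               (≡.trans (≡.cong (λ Q → (Q + + 1) * X - Q) P≡2+3a) (residue a X))
      where
      residue : ∀ a X → (+ 2 + a * + 3 + + 1) * X - (+ 2 + a * + 3) ≡ + 1 + (a + + 1) * (X - + 1) * + 3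
      residue = solve-∀

    324t≡-1 : + 324 * t ≡ - + 1 mod P
    324t≡-1 = begin
      + 324 * t                                    ≈⟨ *-cong (≈-refl {+ 324}) t≡X ⟩
      + 324 * X                                    ≡⟨ inverse (+ 4 * e + + 1) (a + + 1) ⟩
      - ((+ 2 * (+ 4 * e + + 1)) ^ 2 * (+ 3 * (a + + 1)) ^ 4)
                                                   ≡⟨ ≡.cong₂ (λ y z → - (y ^ 2 * z ^ 4)) 2u≡P+1 3v≡P+1 ⟩
      - ((P + + 1) ^ 2 * (P + + 1) ^ 4)            ≈⟨ -‿cong (*-cong (^-cong 2 P+1≡1) (^-cong 4 P+1≡1)) ⟩
      - + 1                                        ∎
      where
      open Modulo P
      open ≈-Reasoning
      shift : ∀ P X → (P + + 1) * X - P ≡ X + (X - + 1) * P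
      shift = solve-∀
      t≡X : t ≡ X mod P
      t≡X = multiple⇒≈ (X - + 1) (shift P X)
      inverse : ∀ u v → + 324 * - (u ^ 2 * v ^ 4) ≡ - ((+ 2 * u) ^ 2 * (+ 3 * v) ^ 4)
      inverse = solve 2 (λ u v → con (+ 324) :* :- (u :^ 2 :* v :^ 4)
                                 := :- ((con (+ 2) :* u) :^ 2 :* (con (+ 3) :* v) :^ 4)) ≡.refl
      double : ∀ e → + 2 * (+ 4 * e + + 1) ≡ + 1 + e * + 8 + + 1
      double = solve-∀
      triple : ∀ a → + 3 * (a + + 1) ≡ + 2 + a * + 3 + + 1
      triple = solve-∀
      2u≡P+1 : + 2 * (+ 4 * e + + 1) ≡ P + + 1
      2u≡P+1 = ≡.trans (double e) (≡.sym (≡.cong (_+ + 1) P≡1+8e))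
      3v≡P+1 : + 3 * (a + + 1) ≡ P + + 1
      3v≡P+1 = ≡.trans (triple a) (≡.sym (≡.cong (_+ + 1) P≡2+3a))
      P+1≡1 : P + + 1 ≡ + 1 mod P
      P+1≡1 = +-absorbˡ (+ 1) ∣-refl

    [lam+24]²≡648 : (lam + + 24) ^ 2 ≡ + 648 mod P
    [lam+24]²≡648 = begin
      (lam + + 24) ^ 2    ≡⟨ ≡.cong (_^ 2) (shift s P) ⟩
      (P + + 18 * s) ^ 2  ≈⟨ ^-cong 2 (+-absorbˡ (+ 18 * s) ∣-refl) ⟩
      (+ 18 * s) ^ 2      ≡⟨ square s ⟩
      + 324 * s ^ 2       ≈⟨ *-cong (≈-refl {+ 324}) (proj₂ (√2 p-prime p%8≡1)) ⟩
      + 648               ∎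
      where
      open Modulo P
      open ≈-Reasoning
      shift : ∀ s P → + 18 * s - + 24 + P + + 24 ≡ P + + 18 * s
      shift = solve-∀
      square : ∀ s → (+ 18 * s) ^ 2 ≡ + 324 * s ^ 2
      square = solve 1 (λ s → (con (+ 18) :* s) :^ 2 := con (+ 324) :* s :^ 2) ≡.refl

  admissible : Admissible p lam ε δ t A
  admissible = record
    { half-A = half-A ; bezout = bezout ; lam-odd = lam-odd ; lam≡2[3] = lam≡2[3] ; t≡1[3] = t≡1[3]
    ; 324t≡-1 = 324t≡-1 ; [lam+24]²≡648 = [lam+24]²≡648 }

  open Construction p-prime p%3≡2 admissible

  -- Abstract, since checking lemma9p1 would otherwise unfold the coordinates of the septuples.
  abstract
    family : ℕ → Septuple
    family k = septuple (- δ + + 3 * + k)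

    family-good : ∀ k → Good p (family k)
    family-good k = good (- δ + + 3 * + k)
                         (Modulo.multiple⇒≈ (+ 3) (+ k) (≡.cong (_+_ (- δ)) (ℤ.*-comm (+ 3) (+ k))))

    -- C - B grows linearly in k with slope 108p.
    family-injective : ∀ {i j} → family i ≡ family j → i ≡ j
    family-injective {i} {j} family-i≡family-j = ℤ.+-injective (ℤ.*-cancelˡ-≡ (+ 108 * P) (+ i) (+ j)
        {{ℤ.i*j≢0 (+ 108) P {{_}} {{prime⇒nonZero p-prime}}}}
        (cancelˡ {+ 4 * P * ε - + 36 * P * δ - + 18 * t}
          (≡.trans (≡.sym (C-B (+ i))) (≡.trans (≡.cong C-minus-B family-i≡family-j) (C-B (+ j))))))
      where
      C-minus-B : Septuple → ℤ
      C-minus-B (_ , B , C , _) = C - B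
      slope : ∀ P lam ε δ t k → let ps = lam , + 1 , ε , δ , - δ + + 3 * k , t , + 1 in
              coordC P ps - coordB P ps ≡ (+ 4 * P * ε - + 36 * P * δ - + 18 * t) + + 108 * P * k
      slope = solve 6 (λ P lam ε δ t k →
        Poly.C P lam (con (+ 1)) ε δ (:- δ :+ con (+ 3) :* k) t (con (+ 1))
          :- Poly.B P lam (con (+ 1)) ε δ (:- δ :+ con (+ 3) :* k) t (con (+ 1))
        := (con (+ 4) :* P :* ε :- con (+ 36) :* P :* δ :- con (+ 18) :* t) :+ con (+ 108) :* P :* k) ≡.refl
      C-B : ∀ k → C-minus-B (septuple (- δ + + 3 * k)) ≡ (+ 4 * P * ε - + 36 * P * δ - + 18 * t) + + 108 * P * k
      C-B = slope P lam ε δ t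
      cancelˡ : ∀ {c x y} → c + x ≡ c + y → x ≡ y
      cancelˡ {c} {x} {y} c+x≡c+y =
        ≡.trans (≡.sym (recover c x)) (≡.trans (≡.cong (_- c) c+x≡c+y) (recover c y))
        where
        recover : ∀ c x → c + x - c ≡ x
        recover = solve-∀

lemma9p1 : (p : ℕ) → Prime p → p % 8 ≡ 1 → p % 3 ≡ 2 → Infinite (Good p)
lemma9p1 p p-prime p%8≡1 p%3≡2 = infinite-if-injective {S = Good p} family family-injective family-good
  where open Parameters p-prime p%8≡1 p%3≡2
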